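{- Let $\Phi$ be the root system of type $B_n$ and $\Phi_A$ the root system of type $A_n$, and for $u\in W(\Phi)$ let $u_A\in W(\Phi_A)$ be as defined in the context. If $w\in W(\Phi)$ avoids the type $A_3$ patterns $3142$, $2413$ and the two type $B_2$ patterns of length two, then $w_A\in W(\Phi_A)$ also avoids these patterns.
   Context: Type $B_n$: $\Phi=\{\pm e_i\pm e_j,\pm e_i\}\subset\mathbb R^n$, positive roots $e_i\pm e_j$ ($i<j$), $e_i$, simple roots $\alpha_i=e_i-e_{i+1}$ ($i<n$), $\alpha_n=e_n$. Let $Q_A\subseteq\Phi^+$ be the set of small roots, i.e. positive roots $\sum c_i\alpha_i$ with all $c_i\in\{0,1\}$ (these are $\alpha_i+\alpha_{i+1}+\cdots+\alpha_j$, $i\le j$). Type $A_n$: $\Phi_A=\{e_i-e_j\}\subset\mathbb R^{n+1}$ with positive roots $e_i-e_j$, $i<j$. Let $\phi:Q_A\to\Phi_A^+$ be the bijection induced linearly by $\alpha_i\mapsto e_i-e_{i+1}$; for $u\in W(\Phi)$, $u_A$ is the unique element of $W(\Phi_A)$ with $I_{\Phi_A}(u_A)=\phi(I_\Phi(u)\cap Q_A)$ (such an element exists since $\phi$ preserves biconvexity). Here $I_\Phi(w)=\{\alpha\in\Phi^+:w\alpha\in-\Phi^+\}$. Patterns: a subsystem is $\Psi\cap U$ for a subspace $U$ of the ambient space of a root system $\Psi$, with positive roots $\Psi^+\cap U$. An element contains $3142$ (resp. $2413$) if for some $U$, $\Psi\cap U$ is of type $A_3$ with simple roots $a_1,a_2,a_3$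 ($a_1\perp a_3$) and the inversion set intersected with $U$ is $\{a_1,a_3,a_1+a_2+a_3\}$ (resp. $\{a_2,a_1+a_2,a_2+a_3\}$); it contains a type $B_2$ pattern of length two if for some $U$, $\Psi\cap U$ is of type $B_2$ with simple roots $b_1$ (long), $b_2$ (short), positive roots $b_1,b_2,b_1+b_2,b_1+2b_2$, and the inversion set intersected with $U$ is $\{b_1,b_1+b_2\}$ or $\{b_2,b_1+2b_2\}$. Avoiding means not containing. -}

module Defs where

open import Data.Nat using (ℕ; zero; suc)
open import Data.Nat.Properties using () renaming (_≟_ to _≟ℕ_)
open import Data.Integer using (ℤ; 0ℤ; 1ℤ; _+_; _*_; -_; _-_)
open import Data.Fin using (Fin; toℕ; _<_)
open import Data.Fin.Permutation using (Permutation′; _⟨$⟩ˡ_)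
open import Data.Vec using (Vec; []; _∷_; replicate; zipWith; map; lookup; tabulate; foldr; _[_]≔_)
open import Data.Bool using (Bool; true; false; if_then_else_)
open import Data.Product using (Σ; ∃; _×_; _,_)
open import Data.Sum using (_⊎_)
open import Relation.Nullary using (¬_)
open import Relation.Nullary.Decidable using (⌊_⌋)
open import Relation.Binary.PropositionalEquality using (_≡_; _≢_)
open import Function.Bundles using (_⇔_)

infixl 6 _+ᵥ_ _-ᵥ_
infixl 7 _•_

_+ᵥ_ : ∀ {m} → Vec ℤ m → Vec ℤ m → Vec ℤ m
_+ᵥ_ = zipWith _+_

negᵥ : ∀ {m} → Vec ℤ m → Vec ℤ m
negᵥ = map (λ x → - x)

_-ᵥ_ : ∀ {m} → Vec ℤ m → Vec ℤ m → Vec ℤ m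
u -ᵥ v = u +ᵥ negᵥ v

_•_ : ∀ {m} → ℤ → Vec ℤ m → Vec ℤ m
c • v = map (c *_) v

0ᵥ : ∀ {m} → Vec ℤ m
0ᵥ {m} = replicate m 0ℤ

e : ∀ {m} → Fin m → Vec ℤ m
e {m} i = replicate m 0ℤ [ i ]≔ 1ℤ

dot : ∀ {m} → Vec ℤ m → Vec ℤ m → ℤ
dot u v = foldr _ _+_ 0ℤ (zipWith _*_ u v)

lincomb : ∀ {k m} → Vec ℤ k → (Fin k → Vec ℤ m) → Vec ℤ m
lincomb {k} c f = foldr _ _+ᵥ_ 0ᵥ (tabulate (λ i → lookup c i • f i))

[_≡ℕ_] : ℕ → ℕ → ℤ
[ a ≡ℕ b ] = if ⌊ a ≟ℕ b ⌋ then 1ℤ else 0ℤ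

data PosB {n : ℕ} : Vec ℤ n → Set where
  diffB  : ∀ {i j : Fin n} → i < j → PosB (e i -ᵥ e j)
  sumB   : ∀ {i j : Fin n} → i < j → PosB (e i +ᵥ e j)
  shortB : ∀ (i : Fin n) → PosB (e i)

-- simple roots α_i = e_i - e_{i+1} (i<n), α_n = e_n  (0-indexed: i = 0..n-1)
simpleB : ∀ {n} → Fin n → Vec ℤ n
simpleB {n} i = tabulate (λ k → [ toℕ k ≡ℕ toℕ i ] - [ toℕ k ≡ℕ suc (toℕ i) ])

-- W(B_n) = signed permutations:  w e_i = s_i e_{π i}
record SignedPerm (n : ℕ) : Set where
  field
    perm : Permutation′ n
    sign : Fin n → Bool        -- true means s_i = -1

open SignedPerm

actB : ∀ {n} → SignedPerm n → Vec ℤ n → Vec ℤ n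
actB w v = tabulate (λ j →
  let i = perm w ⟨$⟩ˡ j in
  if sign w i then - lookup v i else lookup v i)

InvB : ∀ {n} → SignedPerm n → Vec ℤ n → Set
InvB w α = PosB α × PosB (negᵥ (actB w α))

data PosA {n : ℕ} : Vec ℤ (suc n) → Set where
  diffA : ∀ {i j : Fin (suc n)} → i < j → PosA (e i -ᵥ e j)

simpleA : ∀ {n} → Fin n → Vec ℤ (suc n)
simpleA {n} i = tabulate (λ k → [ toℕ k ≡ℕ toℕ i ] - [ toℕ k ≡ℕ suc (toℕ i) ])

actA : ∀ {n} → Permutation′ (suc n) → Vec ℤ (suc n) → Vec ℤ (suc n)
actA π v = tabulate (λ j → lookup v (π ⟨$⟩ˡ j))

InvA : ∀ {n} → Permutation′ (suc n) → Vec ℤ (suc n) → Set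
InvA π α = PosA α × PosA (negᵥ (actA π α))

-- The map u ↦ u_A, as a relation:  I(u_A) = φ(I(u) ∩ Q_A)

Is01 : ℤ → Set
Is01 c = (c ≡ 0ℤ) ⊎ (c ≡ 1ℤ)

-- β ∈ φ(I(w) ∩ Q_A): β = Σ c_i (e_i - e_{i+1}) for some c ∈ {0,1}^n with
-- Σ c_i α_i a small root lying in I(w).
InPhiImage : ∀ {n} → SignedPerm n → Vec ℤ (suc n) → Set
InPhiImage {n} w β =
  Σ (Vec ℤ n) λ c →
    ((i : Fin n) → Is01 (lookup c i)) ×
    InvB w (lincomb c simpleB) ×
    (lincomb c simpleA ≡ β)

IsAPart : ∀ {n} → SignedPerm n → Permutation′ (suc n) → Set
IsAPart w v = ∀ β → InvA v β ⇔ InPhiImage w β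

-- Patterns, for a root system in ℤ^m given by its positive roots Pos
-- (Φ = Pos ∪ -Pos) and an inversion set Inv ⊆ Pos.

-- membership in the (real/rational) span; denominators cleared
InSpan3 : ∀ {m} → Vec ℤ m → Vec ℤ m → Vec ℤ m → Vec ℤ m → Set
InSpan3 a₁ a₂ a₃ β =
  Σ ℤ λ c₀ → Σ ℤ λ c₁ → Σ ℤ λ c₂ → Σ ℤ λ c₃ →
    (c₀ ≢ 0ℤ) × (c₀ • β ≡ c₁ • a₁ +ᵥ c₂ • a₂ +ᵥ c₃ • a₃)

InSpan2 : ∀ {m} → Vec ℤ m → Vec ℤ m → Vec ℤ m → Set
InSpan2 b₁ b₂ β =
  Σ ℤ λ c₀ → Σ ℤ λ c₁ → Σ ℤ λ c₂ →
    (c₀ ≢ 0ℤ) × (c₀ • β ≡ c₁ • b₁ +ᵥ c₂ • b₂)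

IsA3Sub : ∀ {m} → (Vec ℤ m → Set) → Vec ℤ m → Vec ℤ m → Vec ℤ m → Set
IsA3Sub Pos a₁ a₂ a₃ =
  (dot a₁ a₁ ≡ dot a₂ a₂) × (dot a₂ a₂ ≡ dot a₃ a₃) ×
  (dot a₁ a₃ ≡ 0ℤ) ×
  ((dot a₁ a₂ + dot a₁ a₂) ≡ - dot a₁ a₁) ×
  ((dot a₂ a₃ + dot a₂ a₃) ≡ - dot a₂ a₂) ×
  (∀ β → (Pos β × InSpan3 a₁ a₂ a₃ β) ⇔
     ((β ≡ a₁) ⊎ (β ≡ a₂) ⊎ (β ≡ a₃) ⊎ (β ≡ a₁ +ᵥ a₂) ⊎
      (β ≡ a₂ +ᵥ a₃) ⊎ (β ≡ a₁ +ᵥ a₂ +ᵥ a₃)))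

IsB2Sub : ∀ {m} → (Vec ℤ m → Set) → Vec ℤ m → Vec ℤ m → Set
IsB2Sub Pos b₁ b₂ =
  (dot b₁ b₁ ≡ dot b₂ b₂ + dot b₂ b₂) ×
  (dot b₁ b₂ ≡ - dot b₂ b₂) ×
  (dot b₂ b₂ ≢ 0ℤ) ×
  (∀ β → (Pos β × InSpan2 b₁ b₂ β) ⇔
     ((β ≡ b₁) ⊎ (β ≡ b₂) ⊎ (β ≡ b₁ +ᵥ b₂) ⊎ (β ≡ b₁ +ᵥ b₂ +ᵥ b₂)))

Contains3142 : ∀ {m} → (Vec ℤ m → Set) → (Vec ℤ m → Set) → Set
Contains3142 Pos Inv =
  ∃ λ a₁ → ∃ λ a₂ → ∃ λ a₃ → IsA3Sub Pos a₁ a₂ a₃ ×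
    (∀ β → (Inv β × InSpan3 a₁ a₂ a₃ β) ⇔
       ((β ≡ a₁) ⊎ (β ≡ a₃) ⊎ (β ≡ a₁ +ᵥ a₂ +ᵥ a₃)))

Contains2413 : ∀ {m} → (Vec ℤ m → Set) → (Vec ℤ m → Set) → Set
Contains2413 Pos Inv =
  ∃ λ a₁ → ∃ λ a₂ → ∃ λ a₃ → IsA3Sub Pos a₁ a₂ a₃ ×
    (∀ β → (Inv β × InSpan3 a₁ a₂ a₃ β) ⇔
       ((β ≡ a₂) ⊎ (β ≡ a₁ +ᵥ a₂) ⊎ (β ≡ a₂ +ᵥ a₃)))

ContainsB2len2 : ∀ {m} → (Vec ℤ m → Set) → (Vec ℤ m → Set) → Set
ContainsB2len2 Pos Inv =
  ∃ λ b₁ → ∃ λ b₂ → IsB2Sub Pos b₁ b₂ ×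
    ((∀ β → (Inv β × InSpan2 b₁ b₂ β) ⇔ ((β ≡ b₁) ⊎ (β ≡ b₁ +ᵥ b₂)))
     ⊎
     (∀ β → (Inv β × InSpan2 b₁ b₂ β) ⇔ ((β ≡ b₂) ⊎ (β ≡ b₁ +ᵥ b₂ +ᵥ b₂))))

AvoidsAll : ∀ {m} → (Vec ℤ m → Set) → (Vec ℤ m → Set) → Set
AvoidsAll Pos Inv =
  ¬ Contains3142 Pos Inv × ¬ Contains2413 Pos Inv × ¬ ContainsB2len2 Pos Inv

module Submission where

-- Let ψ : ℤ^(n+1) → ℤ^n forget the last coordinate.  On positive roots of
-- A_n, ψ inverts φ: ψ(e_i - e_j) = e_i - e_j for j < n and ψ(e_i - e_n) = e_i,
-- so IsAPart w w_A says that γ ∈ I(w_A) iff ψγ ∈ I(w).  A_n has no B₂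
-- subsystem (its roots all have the same length), and every A₃ subsystem of
-- A_n has simple roots e_p - e_q, e_q - e_r, e_r - e_s with p < q < r < s,
-- possibly listed in reverse order; both A₃ patterns are invariant under
-- this reversal.  If s < n, the pattern lies in the hyperplane x_n = 0 and ψ
-- carries it to the same pattern of w.  If s = n, ψ turns the six inversion
-- facts of the pattern into facts about e_p - e_q, e_q - e_r, e_p - e_r,
-- e_p, e_q, e_r; deciding whether e_q + e_r ∈ I(w), and using that inversion
-- sets are closed and co-closed under sums of positive roots, yields a B₂
-- pattern of w spanned by e_x - e_y and e_y for some x < y.

open import Defs
open import Data.Nat as ℕ using (ℕ; zero; suc)
import Data.Nat.Properties as ℕP
open import Data.Integer using (ℤ; +_; -[1+_]; 0ℤ; 1ℤ; _+_; _*_; -_; _-_)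
import Data.Integer.Properties as ℤP
open import Data.Integer.Tactic.RingSolver using (solve-∀)
open import Data.Fin as F using (Fin; zero; suc; toℕ; inject₁; fromℕ)
import Data.Fin.Properties as FP
open import Data.Fin.Permutation using (Permutation′; _⟨$⟩ʳ_; _⟨$⟩ˡ_; inverseʳ; inverseˡ)
open import Data.Vec using (Vec; []; _∷_; _∷ʳ_; replicate; lookup; tabulate)
open import Data.Vec.Properties using (tabulate-cong; tabulate∘lookup; lookup∘tabulate; lookup-zipWith; lookup-map; lookup-replicate)
open import Data.Bool using (Bool; true; false; not; if_then_else_)
open import Data.Product using (Σ; ∃; _×_; _,_; proj₁; proj₂)
open import Data.Sum using (_⊎_; inj₁; inj₂)
open import Data.Empty using (⊥; ⊥-elim)
open import Relation.Nullary using (¬_; yes; no; Dec)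
open import Relation.Binary.Definitions using (tri<; tri≈; tri>)
open import Relation.Binary.PropositionalEquality
open import Function.Bundles using (Equivalence; Injection; _⇔_; mk⇔)
open import Function.Properties.Inverse using (↔⇒↣)
open import Data.Sum.Function.Propositional using (_⊎-⇔_)

open Equivalence
open SignedPerm

δ : ∀ {m} → Fin m → Fin m → ℤ
δ i j = [ toℕ i ≡ℕ toℕ j ]

[≡ℕ]-yes : ∀ {a b} → a ≡ b → [ a ≡ℕ b ] ≡ 1ℤ
[≡ℕ]-yes {a} refl with a ℕ.≟ a
... | yes _ = refl
... | no a≢a = ⊥-elim (a≢a refl)

[≡ℕ]-no : ∀ {a b} → a ≢ b → [ a ≡ℕ b ] ≡ 0ℤ
[≡ℕ]-no {a} {b} a≢b with a ℕ.≟ b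
... | yes a≡b = ⊥-elim (a≢b a≡b)
... | no _ = refl

[≡ℕ]-sym : ∀ a b → [ a ≡ℕ b ] ≡ [ b ≡ℕ a ]
[≡ℕ]-sym a b = by-cases (a ℕ.≟ b)
  where
  by-cases : Dec (a ≡ b) → [ a ≡ℕ b ] ≡ [ b ≡ℕ a ]
  by-cases (yes a≡b) = trans ([≡ℕ]-yes a≡b) (sym ([≡ℕ]-yes (sym a≡b)))
  by-cases (no a≢b) = trans ([≡ℕ]-no a≢b) (sym ([≡ℕ]-no (λ b≡a → a≢b (sym b≡a))))

δ-refl : ∀ {m} (i : Fin m) → δ i i ≡ 1ℤ
δ-refl i = [≡ℕ]-yes refl

δ-≢ : ∀ {m} {i j : Fin m} → i ≢ j → δ i j ≡ 0ℤ
δ-≢ i≢j = [≡ℕ]-no (λ eq → i≢j (FP.toℕ-injective eq))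

δ-sym : ∀ {m} (i j : Fin m) → δ i j ≡ δ j i
δ-sym i j = [≡ℕ]-sym (toℕ i) (toℕ j)

δ-suc : ∀ {m} (i j : Fin m) → δ (suc i) (suc j) ≡ δ i j
δ-suc i j with i F.≟ j
... | yes refl = trans (δ-refl (suc i)) (sym (δ-refl i))
... | no i≢j = trans (δ-≢ (λ eq → i≢j (FP.suc-injective eq))) (sym (δ-≢ i≢j))

δ-01 : ∀ {m} (i j : Fin m) → δ i j ≡ 0ℤ ⊎ δ i j ≡ 1ℤ
δ-01 i j with i F.≟ j
... | yes refl = inj₂ (δ-refl i)
... | no i≢j = inj₁ (δ-≢ i≢j)

>⇒≢ : ∀ {m} {i j : Fin m} → j F.< i → i ≢ j
>⇒≢ j<i i≡j = FP.<⇒≢ j<i (sym i≡j)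

lookup-e : ∀ {m} (i k : Fin m) → lookup (e i) k ≡ δ i k
lookup-e zero zero = refl
lookup-e zero (suc k) = lookup-replicate k 0ℤ
lookup-e (suc i) zero = refl
lookup-e (suc i) (suc k) = trans (lookup-e i k) (sym (δ-suc i k))

lookup-e-self : ∀ {m} (k : Fin m) → lookup (e k) k ≡ 1ℤ
lookup-e-self k = trans (lookup-e k k) (δ-refl k)

lookup-e-other : ∀ {m} {k l : Fin m} → l ≢ k → lookup (e l) k ≡ 0ℤ
lookup-e-other {k = k} {l} l≢k = trans (lookup-e l k) (δ-≢ l≢k)

dot-0ˡ : ∀ {m} (v : Vec ℤ m) → dot 0ᵥ v ≡ 0ℤ
dot-0ˡ [] = refl
dot-0ˡ (x ∷ v) = trans (ℤP.+-identityˡ _) (dot-0ˡ v)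

dot-comm : ∀ {m} (u v : Vec ℤ m) → dot u v ≡ dot v u
dot-comm [] [] = refl
dot-comm (x ∷ u) (y ∷ v) = cong₂ _+_ (ℤP.*-comm x y) (dot-comm u v)

dot-+ˡ : ∀ {m} (u v w : Vec ℤ m) → dot (u +ᵥ v) w ≡ dot u w + dot v w
dot-+ˡ [] [] [] = refl
dot-+ˡ (x ∷ u) (y ∷ v) (z ∷ w) =
  trans (cong (λ a → (x + y) * z + a) (dot-+ˡ u v w)) (shuffle x y z (dot u w) (dot v w))
  where
  shuffle : ∀ x y z a b → (x + y) * z + (a + b) ≡ (x * z + a) + (y * z + b)
  shuffle = solve-∀

dot-+ʳ : ∀ {m} (u v w : Vec ℤ m) → dot u (v +ᵥ w) ≡ dot u v + dot u w
dot-+ʳ u v w =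
  trans (dot-comm u (v +ᵥ w)) (trans (dot-+ˡ v w u) (cong₂ _+_ (dot-comm v u) (dot-comm w u)))

dot-negˡ : ∀ {m} (u w : Vec ℤ m) → dot (negᵥ u) w ≡ - dot u w
dot-negˡ [] [] = refl
dot-negˡ (x ∷ u) (z ∷ w) = trans (cong (λ a → (- x) * z + a) (dot-negˡ u w)) (shuffle x z (dot u w))
  where
  shuffle : ∀ x z a → (- x) * z + - a ≡ - (x * z + a)
  shuffle = solve-∀

dot--ˡ : ∀ {m} (u v w : Vec ℤ m) → dot (u -ᵥ v) w ≡ dot u w - dot v w
dot--ˡ u v w = trans (dot-+ˡ u (negᵥ v) w) (cong (λ a → dot u w + a) (dot-negˡ v w))

dot-ee : ∀ {m} (i j : Fin m) → dot (e i) (e j) ≡ δ i j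
dot-ee {suc m} zero zero = cong (λ a → 1ℤ + a) (dot-0ˡ (replicate m 0ℤ))
dot-ee zero (suc j) = trans (ℤP.+-identityˡ _) (dot-0ˡ (e j))
dot-ee (suc i) zero = trans (ℤP.+-identityˡ _) (trans (dot-comm (e i) 0ᵥ) (dot-0ˡ (e i)))
dot-ee (suc i) (suc j) = trans (ℤP.+-identityˡ _) (trans (dot-ee i j) (sym (δ-suc i j)))

dot-diff : ∀ {m} (p q r s : Fin m) →
  dot (e p -ᵥ e q) (e r -ᵥ e s) ≡ (δ p r - δ p s) - (δ q r - δ q s)
dot-diff p q r s = begin
  dot (e p -ᵥ e q) (e r -ᵥ e s)
    ≡⟨ dot--ˡ (e p) (e q) _ ⟩
  dot (e p) (e r -ᵥ e s) - dot (e q) (e r -ᵥ e s)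
    ≡⟨ cong₂ _-_ (along p) (along q) ⟩
  (δ p r - δ p s) - (δ q r - δ q s) ∎
  where
  open ≡-Reasoning
  along : ∀ t → dot (e t) (e r -ᵥ e s) ≡ δ t r - δ t s
  along t = trans (dot-comm (e t) _) (trans (dot--ˡ (e r) (e s) (e t))
    (cong₂ _-_ (trans (dot-ee r t) (δ-sym r t)) (trans (dot-ee s t) (δ-sym s t))))

vec-ext : ∀ {m} {u v : Vec ℤ m} → (∀ k → lookup u k ≡ lookup v k) → u ≡ v
vec-ext {u = u} {v} same =
  trans (sym (tabulate∘lookup u)) (trans (tabulate-cong same) (tabulate∘lookup v))

lookup-+ᵥ : ∀ {m} (u v : Vec ℤ m) k → lookup (u +ᵥ v) k ≡ lookup u k + lookup v k
lookup-+ᵥ u v k = lookup-zipWith _+_ k u v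

lookup-negᵥ : ∀ {m} (u : Vec ℤ m) k → lookup (negᵥ u) k ≡ - lookup u k
lookup-negᵥ u k = lookup-map k -_ u

lookup--ᵥ : ∀ {m} (u v : Vec ℤ m) k → lookup (u -ᵥ v) k ≡ lookup u k - lookup v k
lookup--ᵥ u v k = trans (lookup-+ᵥ u (negᵥ v) k) (cong (λ a → lookup u k + a) (lookup-negᵥ v k))

lookup-• : ∀ {m} (c : ℤ) (u : Vec ℤ m) k → lookup (c • u) k ≡ c * lookup u k
lookup-• c u k = lookup-map k (c *_) u

+ᵥ-comm : ∀ {m} (u v : Vec ℤ m) → u +ᵥ v ≡ v +ᵥ u
+ᵥ-comm [] [] = refl
+ᵥ-comm (x ∷ u) (y ∷ v) = cong₂ _∷_ (ℤP.+-comm x y) (+ᵥ-comm u v)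

+ᵥ-reverse : ∀ {m} (u v w : Vec ℤ m) → u +ᵥ v +ᵥ w ≡ w +ᵥ v +ᵥ u
+ᵥ-reverse [] [] [] = refl
+ᵥ-reverse (x ∷ u) (y ∷ v) (z ∷ w) = cong₂ _∷_ (reverse x y z) (+ᵥ-reverse u v w)
  where
  reverse : ∀ x y z → x + y + z ≡ z + y + x
  reverse = solve-∀

negᵥ-involutive : ∀ {m} (u : Vec ℤ m) → negᵥ (negᵥ u) ≡ u
negᵥ-involutive [] = refl
negᵥ-involutive (x ∷ u) = cong₂ _∷_ (ℤP.neg-involutive x) (negᵥ-involutive u)

negᵥ-distrib : ∀ {m} (u v : Vec ℤ m) → negᵥ (u +ᵥ v) ≡ negᵥ u +ᵥ negᵥ v
negᵥ-distrib [] [] = refl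
negᵥ-distrib (x ∷ u) (y ∷ v) = cong₂ _∷_ (ℤP.neg-distrib-+ x y) (negᵥ-distrib u v)

-ᵥ-0 : ∀ {m} (v : Vec ℤ m) → v -ᵥ 0ᵥ ≡ v
-ᵥ-0 [] = refl
-ᵥ-0 (x ∷ v) = cong₂ _∷_ (ℤP.+-identityʳ x) (-ᵥ-0 v)

•-zeroˡ : ∀ {m} (v : Vec ℤ m) → 0ℤ • v ≡ 0ᵥ
•-zeroˡ [] = refl
•-zeroˡ (x ∷ v) = cong (0ℤ ∷_) (•-zeroˡ v)

•-identity : ∀ {m} (v : Vec ℤ m) → 1ℤ • v ≡ v
•-identity [] = refl
•-identity (x ∷ v) = cong₂ _∷_ (ℤP.*-identityˡ x) (•-identity v)

+ᵥ-identityʳ : ∀ {m} (v : Vec ℤ m) → v +ᵥ 0ᵥ ≡ v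
+ᵥ-identityʳ [] = refl
+ᵥ-identityʳ (x ∷ v) = cong₂ _∷_ (ℤP.+-identityʳ x) (+ᵥ-identityʳ v)

+ᵥ-identityˡ : ∀ {m} (v : Vec ℤ m) → 0ᵥ +ᵥ v ≡ v
+ᵥ-identityˡ [] = refl
+ᵥ-identityˡ (x ∷ v) = cong₂ _∷_ (ℤP.+-identityˡ x) (+ᵥ-identityˡ v)

telescope : ∀ {m} (a b c : Vec ℤ m) → (a -ᵥ b) +ᵥ (b -ᵥ c) ≡ a -ᵥ c
telescope [] [] [] = refl
telescope (x ∷ a) (y ∷ b) (z ∷ c) = cong₂ _∷_ (tel x y z) (telescope a b c)
  where
  tel : ∀ x y z → (x + - y) + (y + - z) ≡ x + - z
  tel = solve-∀

telescope₃ : ∀ {m} (a b c d : Vec ℤ m) → (a -ᵥ b) +ᵥ (b -ᵥ c) +ᵥ (c -ᵥ d) ≡ a -ᵥ d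
telescope₃ a b c d =
  trans (cong (_+ᵥ (c -ᵥ d)) (telescope a b c)) (telescope a c d)

+ᵥ-via : ∀ {m} (a b c : Vec ℤ m) → a +ᵥ b ≡ (b +ᵥ c) +ᵥ (a -ᵥ c)
+ᵥ-via [] [] [] = refl
+ᵥ-via (x ∷ a) (y ∷ b) (z ∷ c) = cong₂ _∷_ (via x y z) (+ᵥ-via a b c)
  where
  via : ∀ x y z → x + y ≡ (y + z) + (x + - z)
  via = solve-∀

-ᵥ-+ᵥ : ∀ {m} (a b : Vec ℤ m) → (a -ᵥ b) +ᵥ b ≡ a
-ᵥ-+ᵥ [] [] = refl
-ᵥ-+ᵥ (x ∷ a) (y ∷ b) = cong₂ _∷_ (cancel x y) (-ᵥ-+ᵥ a b)
  where
  cancel : ∀ x y → (x + - y) + y ≡ x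
  cancel = solve-∀

-ᵥ-+ᵥ-+ᵥ : ∀ {m} (a b : Vec ℤ m) → (a -ᵥ b) +ᵥ b +ᵥ b ≡ a +ᵥ b
-ᵥ-+ᵥ-+ᵥ a b = cong (_+ᵥ b) (-ᵥ-+ᵥ a b)

data LastOrInject {n : ℕ} : Fin (suc n) → Set where
  last   : LastOrInject (fromℕ n)
  inject : (i : Fin n) → LastOrInject (inject₁ i)

last-or-inject : ∀ {n} (i : Fin (suc n)) → LastOrInject i
last-or-inject {zero} zero = last
last-or-inject {suc n} zero = inject zero
last-or-inject {suc n} (suc i) with last-or-inject i
... | last = last
... | inject j = inject (suc j)

last-maximal : ∀ {n} {j : Fin (suc n)} → ¬ (fromℕ n F.< j)
last-maximal {n} {j} lt = ℕP.<⇒≱ lt (FP.≤fromℕ j)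

below⇒inject : ∀ {n} {i j : Fin (suc n)} → i F.< j → ∃ λ i′ → i ≡ inject₁ i′
below⇒inject {i = i} lt with last-or-inject i
... | last = ⊥-elim (last-maximal lt)
... | inject i′ = i′ , refl

inject₁-<⁻ : ∀ {n} {i j : Fin n} → inject₁ i F.< inject₁ j → i F.< j
inject₁-<⁻ {i = i} {j} = subst₂ ℕ._<_ (FP.toℕ-inject₁ i) (FP.toℕ-inject₁ j)

inject₁-< : ∀ {n} {i j : Fin n} → i F.< j → inject₁ i F.< inject₁ j
inject₁-< {i = i} {j} = subst₂ ℕ._<_ (sym (FP.toℕ-inject₁ i)) (sym (FP.toℕ-inject₁ j))

inject₁<last : ∀ {n} (i : Fin n) → inject₁ i F.< fromℕ n
inject₁<last {n} i =
  subst₂ ℕ._<_ (sym (FP.toℕ-inject₁ i)) (sym (FP.toℕ-fromℕ n)) (FP.toℕ<n i)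

ψ : ∀ {n} → Vec ℤ (suc n) → Vec ℤ n
ψ {zero} (x ∷ []) = []
ψ {suc n} (x ∷ v) = x ∷ ψ v

ι : ∀ {n} → Vec ℤ n → Vec ℤ (suc n)
ι v = v ∷ʳ 0ℤ

ψ∘ι : ∀ {n} (v : Vec ℤ n) → ψ (ι v) ≡ v
ψ∘ι [] = refl
ψ∘ι (x ∷ v) = cong (x ∷_) (ψ∘ι v)

ι-injective : ∀ {n} {u v : Vec ℤ n} → ι u ≡ ι v → u ≡ v
ι-injective {u = u} {v} eq = trans (sym (ψ∘ι u)) (trans (cong ψ eq) (ψ∘ι v))

ψ-+ᵥ : ∀ {n} (u v : Vec ℤ (suc n)) → ψ (u +ᵥ v) ≡ ψ u +ᵥ ψ v
ψ-+ᵥ {zero} (x ∷ []) (y ∷ []) = refl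
ψ-+ᵥ {suc n} (x ∷ u) (y ∷ v) = cong (x + y ∷_) (ψ-+ᵥ u v)

ψ-negᵥ : ∀ {n} (u : Vec ℤ (suc n)) → ψ (negᵥ u) ≡ negᵥ (ψ u)
ψ-negᵥ {zero} (x ∷ []) = refl
ψ-negᵥ {suc n} (x ∷ u) = cong (- x ∷_) (ψ-negᵥ u)

ψ--ᵥ : ∀ {n} (u v : Vec ℤ (suc n)) → ψ (u -ᵥ v) ≡ ψ u -ᵥ ψ v
ψ--ᵥ u v = trans (ψ-+ᵥ u (negᵥ v)) (cong (ψ u +ᵥ_) (ψ-negᵥ v))

ψ-• : ∀ {n} (c : ℤ) (u : Vec ℤ (suc n)) → ψ (c • u) ≡ c • ψ u
ψ-• {zero} c (x ∷ []) = refl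
ψ-• {suc n} c (x ∷ u) = cong (c * x ∷_) (ψ-• c u)

ψ-0 : ∀ {n} → ψ (0ᵥ {suc n}) ≡ 0ᵥ
ψ-0 {zero} = refl
ψ-0 {suc n} = cong (0ℤ ∷_) (ψ-0 {n})

ψ-tabulate : ∀ {n} (f : Fin (suc n) → ℤ) → ψ (tabulate f) ≡ tabulate (λ k → f (inject₁ k))
ψ-tabulate {zero} f = refl
ψ-tabulate {suc n} f = cong (f zero ∷_) (ψ-tabulate (λ k → f (suc k)))

ψ-e-inject : ∀ {n} (i : Fin n) → ψ (e (inject₁ i)) ≡ e i
ψ-e-inject {suc n} zero = cong (1ℤ ∷_) (ψ-0 {n})
ψ-e-inject {suc n} (suc i) = cong (0ℤ ∷_) (ψ-e-inject i)

ψ-e-last : ∀ n → ψ (e (fromℕ n)) ≡ 0ᵥ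
ψ-e-last zero = refl
ψ-e-last (suc n) = cong (0ℤ ∷_) (ψ-e-last n)

ψ-diff-inject : ∀ {n} (i j : Fin n) → ψ (e (inject₁ i) -ᵥ e (inject₁ j)) ≡ e i -ᵥ e j
ψ-diff-inject i j = trans (ψ--ᵥ _ _) (cong₂ _-ᵥ_ (ψ-e-inject i) (ψ-e-inject j))

ψ-diff-last : ∀ {n} (i : Fin n) → ψ (e (inject₁ i) -ᵥ e (fromℕ n)) ≡ e i
ψ-diff-last {n} i =
  trans (ψ--ᵥ _ _) (trans (cong₂ _-ᵥ_ (ψ-e-inject i) (ψ-e-last n)) (-ᵥ-0 _))

ι-0 : ∀ m → ι (0ᵥ {m}) ≡ 0ᵥ
ι-0 zero = refl
ι-0 (suc m) = cong (0ℤ ∷_) (ι-0 m)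

ι-e : ∀ {n} (i : Fin n) → ι (e i) ≡ e (inject₁ i)
ι-e {suc n} zero = cong (1ℤ ∷_) (ι-0 n)
ι-e {suc n} (suc i) = cong (0ℤ ∷_) (ι-e i)

ι-+ᵥ : ∀ {n} (u v : Vec ℤ n) → ι (u +ᵥ v) ≡ ι u +ᵥ ι v
ι-+ᵥ [] [] = refl
ι-+ᵥ (x ∷ u) (y ∷ v) = cong (x + y ∷_) (ι-+ᵥ u v)

ι-negᵥ : ∀ {n} (u : Vec ℤ n) → ι (negᵥ u) ≡ negᵥ (ι u)
ι-negᵥ [] = refl
ι-negᵥ (x ∷ u) = cong (- x ∷_) (ι-negᵥ u)

ι-• : ∀ {n} (c : ℤ) (u : Vec ℤ n) → ι (c • u) ≡ c • ι u
ι-• c [] = cong (_∷ []) (sym (ℤP.*-zeroʳ c))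
ι-• c (x ∷ u) = cong (c * x ∷_) (ι-• c u)

ι--ᵥ : ∀ {n} (u v : Vec ℤ n) → ι (u -ᵥ v) ≡ ι u -ᵥ ι v
ι--ᵥ u v = trans (ι-+ᵥ u (negᵥ v)) (cong (ι u +ᵥ_) (ι-negᵥ v))

ι-diff : ∀ {n} (i j : Fin n) → ι (e i -ᵥ e j) ≡ e (inject₁ i) -ᵥ e (inject₁ j)
ι-diff i j = trans (ι--ᵥ (e i) (e j)) (cong₂ _-ᵥ_ (ι-e i) (ι-e j))

dot-ι : ∀ {n} (u v : Vec ℤ n) → dot (ι u) (ι v) ≡ dot u v
dot-ι [] [] = refl
dot-ι (x ∷ u) (y ∷ v) = cong (λ a → x * y + a) (dot-ι u v)

lincomb-cong : ∀ {k m} (c : Vec ℤ k) {f g : Fin k → Vec ℤ m} →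
  (∀ i → f i ≡ g i) → lincomb c f ≡ lincomb c g
lincomb-cong [] same = refl
lincomb-cong (c₀ ∷ c) same =
  cong₂ (λ a b → c₀ • a +ᵥ b) (same zero) (lincomb-cong c (λ i → same (suc i)))

ψ-lincomb : ∀ {k n} (c : Vec ℤ k) (f : Fin k → Vec ℤ (suc n)) →
  ψ (lincomb c f) ≡ lincomb c (λ i → ψ (f i))
ψ-lincomb [] f = ψ-0
ψ-lincomb (c₀ ∷ c) f = trans (ψ-+ᵥ (c₀ • f zero) _)
  (cong₂ _+ᵥ_ (ψ-• c₀ (f zero)) (ψ-lincomb c (λ i → f (suc i))))

ψ-simpleA : ∀ {n} (i : Fin n) → ψ (simpleA i) ≡ simpleB i
ψ-simpleA i = trans (ψ-tabulate (λ k → [ toℕ k ≡ℕ toℕ i ] - [ toℕ k ≡ℕ suc (toℕ i) ])) (tabulate-cong λ k →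
  cong (λ a → [ a ≡ℕ toℕ i ] - [ a ≡ℕ suc (toℕ i) ]) (FP.toℕ-inject₁ k))

ψ-lincomb-simpleA : ∀ {n} (c : Vec ℤ n) → ψ (lincomb c simpleA) ≡ lincomb c simpleB
ψ-lincomb-simpleA c = trans (ψ-lincomb c simpleA) (lincomb-cong c ψ-simpleA)

gapA : ∀ {n} → Fin n → Vec ℤ (suc n)
gapA k = e (inject₁ k) -ᵥ e (suc k)

simpleA-e : ∀ {n} (i : Fin n) → simpleA i ≡ gapA i
simpleA-e i = vec-ext λ k →
  trans (lookup∘tabulate (λ k → [ toℕ k ≡ℕ toℕ i ] - [ toℕ k ≡ℕ suc (toℕ i) ]) k) (sym (trans (lookup--ᵥ (e (inject₁ i)) (e (suc i)) k)
  (cong₂ _-_ (trans (lookup-e (inject₁ i) k)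
                    (trans (cong (λ a → [ a ≡ℕ toℕ k ]) (FP.toℕ-inject₁ i)) ([≡ℕ]-sym _ _)))
             (trans (lookup-e (suc i) k) ([≡ℕ]-sym _ _)))))

Coeffs01 : ∀ {k} → Vec ℤ k → Set
Coeffs01 c = ∀ i → Is01 (lookup c i)

coeffs01-∷ : ∀ {k} {x} {c : Vec ℤ k} → Is01 x → Coeffs01 c → Coeffs01 (x ∷ c)
coeffs01-∷ x01 c01 zero = x01
coeffs01-∷ x01 c01 (suc i) = c01 i

coeffs01-0 : ∀ k → Coeffs01 (replicate k 0ℤ)
coeffs01-0 (suc k) zero = inj₁ refl
coeffs01-0 (suc k) (suc i) = coeffs01-0 k i

lincomb-0 : ∀ {k m} (f : Fin k → Vec ℤ m) → lincomb (replicate k 0ℤ) f ≡ 0ᵥ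
lincomb-0 {zero} f = refl
lincomb-0 {suc k} f =
  trans (cong₂ _+ᵥ_ (•-zeroˡ (f zero)) (lincomb-0 (λ i → f (suc i)))) (+ᵥ-identityʳ 0ᵥ)

lincomb-0∷ : ∀ {k m} (c : Vec ℤ k) (f : Fin k → Vec ℤ m) →
  lincomb c (λ i → 0ℤ ∷ f i) ≡ 0ℤ ∷ lincomb c f
lincomb-0∷ [] f = refl
lincomb-0∷ (c₀ ∷ c) f =
  cong₂ _+ᵥ_ (cong₂ _∷_ (ℤP.*-zeroʳ c₀) refl) (lincomb-0∷ c (λ i → f (suc i)))

telescoping-sum : ∀ {n} {i j : Fin (suc n)} → i F.< j →
  Σ (Vec ℤ n) λ c → Coeffs01 c × lincomb c gapA ≡ e i -ᵥ e j
telescoping-sum {suc n} {zero} {suc zero} _ =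
  1ℤ ∷ replicate n 0ℤ , coeffs01-∷ (inj₂ refl) (coeffs01-0 n) ,
  trans (cong₂ _+ᵥ_ (•-identity (gapA zero)) (lincomb-0 (λ k → gapA (suc k)))) (+ᵥ-identityʳ _)
telescoping-sum {suc n} {zero} {suc (suc j)} _ with telescoping-sum {n} {zero} {suc j} (ℕ.s≤s ℕ.z≤n)
... | c , c01 , sum = 1ℤ ∷ c , coeffs01-∷ (inj₂ refl) c01 ,
  trans (cong₂ _+ᵥ_ (•-identity (gapA zero)) (trans (lincomb-0∷ c gapA) (cong (0ℤ ∷_) sum)))
        (telescope (e zero) (e (suc zero)) (e (suc (suc j))))
telescoping-sum {suc n} {suc i} {suc j} lt with telescoping-sum {n} {i} {j} (ℕ.s≤s⁻¹ lt)
... | c , c01 , sum = 0ℤ ∷ c , coeffs01-∷ (inj₁ refl) c01 ,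
  trans (cong₂ _+ᵥ_ (•-zeroˡ (gapA zero)) (trans (lincomb-0∷ c gapA) (cong (0ℤ ∷_) sum)))
        (+ᵥ-identityˡ _)

small-root : ∀ {n} {i j : Fin (suc n)} → i F.< j →
  Σ (Vec ℤ n) λ c → Coeffs01 c × lincomb c simpleA ≡ e i -ᵥ e j
small-root lt with telescoping-sum lt
... | c , c01 , sum = c , c01 , trans (lincomb-cong c simpleA-e) sum

ψ-PosA : ∀ {n} {γ} → PosA {n} γ → PosB (ψ γ)
ψ-PosA (diffA {i} {j} lt) with last-or-inject i | last-or-inject j
... | last | _ = ⊥-elim (last-maximal lt)
... | inject i′ | last = subst PosB (sym (ψ-diff-last i′)) (shortB i′)
... | inject i′ | inject j′ = subst PosB (sym (ψ-diff-inject i′ j′)) (diffB (inject₁-<⁻ lt))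

-- the two directions of "γ ∈ I(w_A) iff ψγ ∈ I(w)"; the second needs γ ∈ Φ_A⁺
-- to write γ as φ of a small root
module InversionCorrespondence {n : ℕ} (w : SignedPerm n) (wA : Permutation′ (suc n))
  (w-A : IsAPart w wA) where

  inv-A⇒B : ∀ {γ} → InvA wA γ → InvB w (ψ γ)
  inv-A⇒B {γ} inv with to (w-A γ) inv
  ... | c , _ , invB , φ-c≡γ =
    subst (InvB w) (trans (sym (ψ-lincomb-simpleA c)) (cong ψ φ-c≡γ)) invB

  inv-B⇒A : ∀ {γ} → PosA {n} γ → InvB w (ψ γ) → InvA wA γ
  inv-B⇒A {γ} (diffA lt) invB with small-root lt
  ... | c , c01 , φ-c≡γ = from (w-A γ)
    (c , c01 , subst (InvB w) (sym (trans (sym (ψ-lincomb-simpleA c)) (cong ψ φ-c≡γ))) invB , φ-c≡γ)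

-- Inversion sets of B_n are closed and co-closed: if γ = α + β with
-- α, β, γ ∈ Φ⁺, then α, β ∈ I(w) ⇒ γ ∈ I(w) and α, β ∉ I(w) ⇒ γ ∉ I(w).
-- This follows from linearity of w, the fact that w maps roots to roots,
-- and a height functional that is positive on Φ⁺.

lookup-actB : ∀ {n} (w : SignedPerm n) (v : Vec ℤ n) j →
  lookup (actB w v) j ≡
    (if sign w (perm w ⟨$⟩ˡ j) then - lookup v (perm w ⟨$⟩ˡ j) else lookup v (perm w ⟨$⟩ˡ j))
lookup-actB w v j = lookup∘tabulate _ j

actB-+ᵥ : ∀ {n} (w : SignedPerm n) (u v : Vec ℤ n) → actB w (u +ᵥ v) ≡ actB w u +ᵥ actB w v
actB-+ᵥ w u v = vec-ext λ j → let i = perm w ⟨$⟩ˡ j in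
  trans (lookup-actB w (u +ᵥ v) j)
  (trans (signed-+ (sign w i) (lookup-+ᵥ u v i))
         (sym (trans (lookup-+ᵥ (actB w u) (actB w v) j)
                     (cong₂ _+_ (lookup-actB w u j) (lookup-actB w v j)))))
  where
  signed-+ : ∀ b {x y z} → x ≡ y + z →
    (if b then - x else x) ≡ (if b then - y else y) + (if b then - z else z)
  signed-+ true {y = y} {z} refl = ℤP.neg-distrib-+ y z
  signed-+ false refl = refl

actB-negᵥ : ∀ {n} (w : SignedPerm n) (u : Vec ℤ n) → actB w (negᵥ u) ≡ negᵥ (actB w u)
actB-negᵥ w u = vec-ext λ j → let i = perm w ⟨$⟩ˡ j in
  trans (lookup-actB w (negᵥ u) j)
  (trans (signed-neg (sign w i) (lookup-negᵥ u i))
         (sym (trans (lookup-negᵥ (actB w u) j) (cong -_ (lookup-actB w u j)))))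
  where
  signed-neg : ∀ b {x y} → x ≡ - y → (if b then - x else x) ≡ - (if b then - y else y)
  signed-neg true refl = refl
  signed-neg false refl = refl

signed-e : ∀ {m} → Bool → Fin m → Vec ℤ m
signed-e true k = negᵥ (e k)
signed-e false k = e k

negᵥ-signed-e : ∀ {m} b (k : Fin m) → negᵥ (signed-e b k) ≡ signed-e (not b) k
negᵥ-signed-e true k = negᵥ-involutive (e k)
negᵥ-signed-e false k = refl

actB-e : ∀ {n} (w : SignedPerm n) (i : Fin n) → actB w (e i) ≡ signed-e (sign w i) (perm w ⟨$⟩ʳ i)
actB-e w i = vec-ext λ j → trans (lookup-actB w (e i) j) (sym (trans (lookup-signed-e (sign w i) _ j) (coordinate j)))
  where
  lookup-signed-e : ∀ {m} b (k j : Fin m) → lookup (signed-e b k) j ≡ (if b then - δ k j else δ k j)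
  lookup-signed-e true k j = trans (lookup-negᵥ (e k) j) (cong -_ (lookup-e k j))
  lookup-signed-e false k j = lookup-e k j

  coordinate : ∀ j →
    (if sign w i then - δ (perm w ⟨$⟩ʳ i) j else δ (perm w ⟨$⟩ʳ i) j) ≡
    (if sign w (perm w ⟨$⟩ˡ j) then - lookup (e i) (perm w ⟨$⟩ˡ j) else lookup (e i) (perm w ⟨$⟩ˡ j))
  coordinate j with perm w ⟨$⟩ˡ j F.≟ i
  ... | yes π⁻¹j≡i rewrite π⁻¹j≡i | lookup-e i i | δ-refl i
          | trans (cong (perm w ⟨$⟩ʳ_) (sym π⁻¹j≡i)) (inverseʳ (perm w) {j}) | δ-refl j = refl
  ... | no π⁻¹j≢i rewrite lookup-e i (perm w ⟨$⟩ˡ j)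
          | δ-≢ (λ (i≡π⁻¹j : i ≡ perm w ⟨$⟩ˡ j) → π⁻¹j≢i (sym i≡π⁻¹j))
          | δ-≢ (λ (πi≡j : perm w ⟨$⟩ʳ i ≡ j) →
                   π⁻¹j≢i (trans (cong (perm w ⟨$⟩ˡ_) (sym πi≡j)) (inverseˡ (perm w) {i})))
          with sign w i | sign w (perm w ⟨$⟩ˡ j)
  ... | true | true = refl
  ... | true | false = refl
  ... | false | true = refl
  ... | false | false = refl

IsRootB : ∀ {n} → Vec ℤ n → Set
IsRootB v = PosB v ⊎ PosB (negᵥ v)

IsRootB-neg : ∀ {n} {v : Vec ℤ n} → IsRootB (negᵥ v) → IsRootB v
IsRootB-neg (inj₁ p) = inj₂ p
IsRootB-neg {v = v} (inj₂ p) = inj₁ (subst PosB (negᵥ-involutive v) p)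

IsRootB-pair< : ∀ {n} b c {k l : Fin n} → k F.< l → IsRootB (signed-e b k +ᵥ signed-e c l)
IsRootB-pair< false c k<l = e+signed c k<l
  where
  e+signed : ∀ c {k l : Fin _} → k F.< l → IsRootB (e k +ᵥ signed-e c l)
  e+signed false k<l = inj₁ (sumB k<l)
  e+signed true k<l = inj₁ (diffB k<l)
IsRootB-pair< true c {k} {l} k<l = IsRootB-neg (subst IsRootB
  (sym (trans (negᵥ-distrib (signed-e true k) (signed-e c l))
              (cong₂ _+ᵥ_ (negᵥ-signed-e true k) (negᵥ-signed-e c l))))
  (IsRootB-pair< false (not c) k<l))

IsRootB-pair : ∀ {n} b c {k l : Fin n} → k ≢ l → IsRootB (signed-e b k +ᵥ signed-e c l)
IsRootB-pair b c {k} {l} k≢l with FP.<-cmp k l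
... | tri< k<l _ _ = IsRootB-pair< b c k<l
... | tri≈ _ k≡l _ = ⊥-elim (k≢l k≡l)
... | tri> _ _ l<k = subst IsRootB (+ᵥ-comm (signed-e c l) (signed-e b k)) (IsRootB-pair< c b l<k)

perm-injective : ∀ {n} (w : SignedPerm n) {i j : Fin n} → i ≢ j → perm w ⟨$⟩ʳ i ≢ perm w ⟨$⟩ʳ j
perm-injective w i≢j πi≡πj = i≢j (Injection.injective (↔⇒↣ (perm w)) πi≡πj)

actB-root : ∀ {n} (w : SignedPerm n) {γ} → PosB γ → IsRootB (actB w γ)
actB-root w (diffB {i} {j} i<j) = subst IsRootB (sym w-diff)
  (IsRootB-pair (sign w i) (not (sign w j)) (perm-injective w (FP.<⇒≢ i<j)))
  where
  w-diff : actB w (e i -ᵥ e j) ≡ signed-e (sign w i) (perm w ⟨$⟩ʳ i) +ᵥ signed-e (not (sign w j)) (perm w ⟨$⟩ʳ j)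
  w-diff = trans (actB-+ᵥ w (e i) (negᵥ (e j))) (cong₂ _+ᵥ_ (actB-e w i)
    (trans (actB-negᵥ w (e j)) (trans (cong negᵥ (actB-e w j)) (negᵥ-signed-e (sign w j) _))))
actB-root w (sumB {i} {j} i<j) = subst IsRootB (sym w-sum)
  (IsRootB-pair (sign w i) (sign w j) (perm-injective w (FP.<⇒≢ i<j)))
  where
  w-sum : actB w (e i +ᵥ e j) ≡ signed-e (sign w i) (perm w ⟨$⟩ʳ i) +ᵥ signed-e (sign w j) (perm w ⟨$⟩ʳ j)
  w-sum = trans (actB-+ᵥ w (e i) (e j)) (cong₂ _+ᵥ_ (actB-e w i) (actB-e w j))
actB-root w (shortB i) with sign w i | actB-e w i
... | false | wei = inj₁ (subst PosB (sym wei) (shortB _))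
... | true | wei = inj₂ (subst PosB (sym (trans (cong negᵥ wei) (negᵥ-involutive _))) (shortB _))

-- the height functional  v ↦ Σ_k (m - k) v_k,  positive on Φ⁺ of B_m
height : ∀ {m} → Vec ℤ m → ℤ
height [] = 0ℤ
height {suc m} (x ∷ v) = x * + suc m + height v

height-+ᵥ : ∀ {m} (u v : Vec ℤ m) → height (u +ᵥ v) ≡ height u + height v
height-+ᵥ [] [] = refl
height-+ᵥ {suc m} (x ∷ u) (y ∷ v) =
  trans (cong (λ a → (x + y) * + suc m + a) (height-+ᵥ u v)) (shuffle x y (+ suc m) (height u) (height v))
  where
  shuffle : ∀ x y c a b → (x + y) * c + (a + b) ≡ (x * c + a) + (y * c + b)
  shuffle = solve-∀

height-negᵥ : ∀ {m} (u : Vec ℤ m) → height (negᵥ u) ≡ - height u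
height-negᵥ [] = refl
height-negᵥ {suc m} (x ∷ u) =
  trans (cong (λ a → (- x) * + suc m + a) (height-negᵥ u)) (shuffle x (+ suc m) (height u))
  where
  shuffle : ∀ x c a → (- x) * c + - a ≡ - (x * c + a)
  shuffle = solve-∀

height-0 : ∀ m → height (0ᵥ {m}) ≡ 0ℤ
height-0 zero = refl
height-0 (suc m) = trans (ℤP.+-identityˡ _) (height-0 m)

HeightPos HeightNeg : ∀ {m} → Vec ℤ m → Set
HeightPos v = ∃ λ k → height v ≡ + suc k
HeightNeg v = ∃ λ k → height v ≡ -[1+ k ]

height-e : ∀ {m} (i : Fin m) → ∃ λ k → height (e i) ≡ + suc k × suc k ℕ.≤ m
height-e {suc m} zero =
  m , trans (cong₂ _+_ (ℤP.*-identityˡ (+ suc m)) (height-0 m)) (ℤP.+-identityʳ _) , ℕP.≤-refl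
height-e {suc m} (suc i) with height-e i
... | k , eq , k<m = k , trans (ℤP.+-identityˡ _) eq , ℕP.m≤n⇒m≤1+n k<m

height-e-< : ∀ {m} {i j : Fin m} → i F.< j → ∃ λ d → height (e i) ≡ height (e j) + + suc d
height-e-< {suc m} {zero} {suc j} _ with height-e j
... | k , eq , k<m = m ℕ.∸ suc k ,
  trans (cong₂ _+_ (ℤP.*-identityˡ (+ suc m)) (height-0 m))
  (trans (ℤP.+-identityʳ _) (sym (trans (cong₂ _+_ (trans (ℤP.+-identityˡ _) eq) refl) (cong +_ split))))
  where
  split : suc k ℕ.+ suc (m ℕ.∸ suc k) ≡ suc m
  split = trans (ℕP.+-suc (suc k) (m ℕ.∸ suc k)) (cong suc (ℕP.m+[n∸m]≡n k<m))
height-e-< {suc m} {suc i} {suc j} lt with height-e-< {m} {i} {j} (ℕ.s≤s⁻¹ lt)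
... | d , eq = d , trans (ℤP.+-identityˡ _) (trans eq (cong (_+ + suc d) (sym (ℤP.+-identityˡ (height (e j))))))

PosB⇒HeightPos : ∀ {m} {v : Vec ℤ m} → PosB v → HeightPos v
PosB⇒HeightPos (diffB {i} {j} i<j) with height-e-< i<j
... | d , eq = d , trans (height-+ᵥ (e i) (negᵥ (e j)))
  (trans (cong₂ _+_ eq (height-negᵥ (e j))) (cancel (height (e j)) (+ suc d)))
  where
  cancel : ∀ a b → (a + b) + - a ≡ b
  cancel = solve-∀
PosB⇒HeightPos (sumB {i} {j} _) with height-e i | height-e j
... | k , eq , _ | l , eq′ , _ = k ℕ.+ suc l , trans (height-+ᵥ (e i) (e j)) (cong₂ _+_ eq eq′)
PosB⇒HeightPos (shortB i) with height-e i
... | k , eq , _ = k , eq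

NegB⇒HeightNeg : ∀ {m} {v : Vec ℤ m} → PosB (negᵥ v) → HeightNeg v
NegB⇒HeightNeg {v = v} p with PosB⇒HeightPos p
... | k , eq = k , trans (sym (ℤP.neg-involutive (height v))) (cong -_ (trans (sym (height-negᵥ v)) eq))

HeightPos-HeightNeg : ∀ {m} {v : Vec ℤ m} → HeightPos v → HeightNeg v → ⊥
HeightPos-HeightNeg (k , eq) (l , eq′) with trans (sym eq) eq′
... | ()

HeightPos-+ᵥ : ∀ {m} {u v : Vec ℤ m} → HeightPos u → HeightPos v → HeightPos (u +ᵥ v)
HeightPos-+ᵥ {u = u} {v} (k , eq) (l , eq′) = k ℕ.+ suc l , trans (height-+ᵥ u v) (cong₂ _+_ eq eq′)

HeightNeg-+ᵥ : ∀ {m} {u v : Vec ℤ m} → HeightNeg u → HeightNeg v → HeightNeg (u +ᵥ v)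
HeightNeg-+ᵥ {u = u} {v} (k , eq) (l , eq′) = suc (k ℕ.+ l) , trans (height-+ᵥ u v) (cong₂ _+_ eq eq′)

module Biconvexity {n : ℕ} (w : SignedPerm n) where

  -- w γ is a root, so γ ∈ I(w) is decidable for γ ∈ Φ⁺
  inversion? : ∀ {γ} → PosB γ → InvB w γ ⊎ ¬ InvB w γ
  inversion? {γ} p with actB-root w p
  ... | inj₁ q = inj₂ λ (_ , r) → HeightPos-HeightNeg {v = actB w γ} (PosB⇒HeightPos q) (NegB⇒HeightNeg r)
  ... | inj₂ q = inj₁ (p , q)

  non-inversion-height : ∀ {γ} → PosB γ → ¬ InvB w γ → HeightPos (actB w γ)
  non-inversion-height p ¬inv with actB-root w p
  ... | inj₁ q = PosB⇒HeightPos q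
  ... | inj₂ q = ⊥-elim (¬inv (p , q))

  -- w(α + β) = wα + wβ has negative height when wα, wβ do
  closed : ∀ {α β γ} → PosB γ → γ ≡ α +ᵥ β → InvB w α → InvB w β → InvB w γ
  closed {α} {β} p refl (_ , wα<0) (_ , wβ<0) with actB-root w p
  ... | inj₂ q = p , q
  ... | inj₁ q = ⊥-elim (HeightPos-HeightNeg {v = actB w (α +ᵥ β)} (PosB⇒HeightPos q)
    (subst HeightNeg (sym (actB-+ᵥ w α β)) (HeightNeg-+ᵥ {u = actB w α} {v = actB w β} (NegB⇒HeightNeg wα<0) (NegB⇒HeightNeg wβ<0))))

  -- and positive height when wα, wβ do
  co-closed : ∀ {α β γ} → PosB α → PosB β → γ ≡ α +ᵥ β → ¬ InvB w α → ¬ InvB w β → ¬ InvB w γ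
  co-closed {α} {β} pα pβ refl ¬invα ¬invβ (_ , wγ<0) = HeightPos-HeightNeg {v = actB w (α +ᵥ β)}
    (subst HeightPos (sym (actB-+ᵥ w α β))
      (HeightPos-+ᵥ {u = actB w α} {v = actB w β} (non-inversion-height pα ¬invα) (non-inversion-height pβ ¬invβ)))
    (NegB⇒HeightNeg wγ<0)

Shape : Set₁
Shape = ∀ {m} → Vec ℤ m → Vec ℤ m → Vec ℤ m → Vec ℤ m → Set

A3Roots : Shape
A3Roots a₁ a₂ a₃ β = (β ≡ a₁) ⊎ (β ≡ a₂) ⊎ (β ≡ a₃) ⊎ (β ≡ a₁ +ᵥ a₂) ⊎
  (β ≡ a₂ +ᵥ a₃) ⊎ (β ≡ a₁ +ᵥ a₂ +ᵥ a₃)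

A3Sub-roots : ∀ {m} {Pos : Vec ℤ m → Set} {a₁ a₂ a₃} → IsA3Sub Pos a₁ a₂ a₃ →
  ∀ β → (Pos β × InSpan3 a₁ a₂ a₃ β) ⇔ A3Roots a₁ a₂ a₃ β
A3Sub-roots (_ , _ , _ , _ , _ , roots) = roots

dot-self : ∀ {m} {p q : Fin m} → p F.< q → dot (e p -ᵥ e q) (e p -ᵥ e q) ≡ + 2
dot-self {p = p} {q} p<q
  rewrite dot-diff p q p q | δ-refl p | δ-refl q | δ-≢ (FP.<⇒≢ p<q) | δ-≢ (>⇒≢ p<q) = refl

PosA-norm : ∀ {n} {γ} → PosA {n} γ → dot γ γ ≡ + 2
PosA-norm (diffA p<q) = dot-self p<q

pairing-−1 : ∀ {m} {p q r s : Fin m} → p F.< q → r F.< s →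
  dot (e p -ᵥ e q) (e r -ᵥ e s) ≡ -[1+ 0 ] → (q ≡ r) ⊎ (p ≡ s)
pairing-−1 {p = p} {q} {r} {s} _ _ eq with q F.≟ r | p F.≟ s
... | yes q≡r | _ = inj₁ q≡r
... | no _ | yes p≡s = inj₂ p≡s
... | no q≢r | no p≢s = ⊥-elim (impossible (δ-01 p r) (δ-01 q s) (trans (sym (dot-diff p q r s)) eq))
  where
  impossible : (δ p r ≡ 0ℤ ⊎ δ p r ≡ 1ℤ) → (δ q s ≡ 0ℤ ⊎ δ q s ≡ 1ℤ) →
    (δ p r - δ p s) - (δ q r - δ q s) ≢ -[1+ 0 ]
  impossible a b rewrite δ-≢ p≢s | δ-≢ q≢r with a | b
  ... | inj₁ x | inj₁ y rewrite x | y = λ ()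
  ... | inj₁ x | inj₂ y rewrite x | y = λ ()
  ... | inj₂ x | inj₁ y rewrite x | y = λ ()
  ... | inj₂ x | inj₂ y rewrite x | y = λ ()

pairing-common-end : ∀ {m} {p q t : Fin m} → p ≢ q → t ≢ q → dot (e p -ᵥ e q) (e t -ᵥ e q) ≢ 0ℤ
pairing-common-end {p = p} {q} {t} p≢q t≢q eq = nonzero (δ-01 p t) (trans (sym (dot-diff p q t q)) eq)
  where
  nonzero : (δ p t ≡ 0ℤ ⊎ δ p t ≡ 1ℤ) → (δ p t - δ p q) - (δ q t - δ q q) ≢ 0ℤ
  nonzero δ-pt rewrite δ-≢ p≢q | δ-≢ (λ q≡t → t≢q (sym q≡t)) | δ-refl q with δ-pt
  ... | inj₁ x rewrite x = λ ()
  ... | inj₂ x rewrite x = λ ()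

pairing-common-start : ∀ {m} {p q u : Fin m} → p ≢ u → q ≢ p → dot (e p -ᵥ e q) (e p -ᵥ e u) ≢ 0ℤ
pairing-common-start {p = p} {q} {u} p≢u q≢p eq = nonzero (δ-01 q u) (trans (sym (dot-diff p q p u)) eq)
  where
  nonzero : (δ q u ≡ 0ℤ ⊎ δ q u ≡ 1ℤ) → (δ p p - δ p u) - (δ q p - δ q u) ≢ 0ℤ
  nonzero δ-qu rewrite δ-≢ p≢u | δ-≢ q≢p | δ-refl p with δ-qu
  ... | inj₁ x rewrite x = λ ()
  ... | inj₂ x rewrite x = λ ()

data Chain {m} : Vec ℤ m → Vec ℤ m → Vec ℤ m → Set where
  chain : ∀ {p q r s : Fin m} → p F.< q → q F.< r → r F.< s →
          Chain (e p -ᵥ e q) (e q -ᵥ e r) (e r -ᵥ e s)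

-- x + x = -2 forces x = -1: adjacent simple roots of A₃ in A_n pair to -1
halve : ∀ x → x + x ≡ - (+ 2) → x ≡ -[1+ 0 ]
halve (+ zero) ()
halve (+ suc n) ()
halve -[1+ zero ] _ = refl
halve -[1+ suc n ] ()

A3Sub-chain : ∀ {n} {a₁ a₂ a₃ : Vec ℤ (suc n)} → IsA3Sub (PosA {n}) a₁ a₂ a₃ →
  Chain a₁ a₂ a₃ ⊎ Chain a₃ a₂ a₁
A3Sub-chain {n} {a₁} {a₂} {a₃} (_ , _ , ⟨a₁,a₃⟩ , ⟨a₁,a₂⟩ , ⟨a₂,a₃⟩ , roots) =
  classify (positive (inj₁ refl)) (positive (inj₂ (inj₁ refl))) (positive (inj₂ (inj₂ (inj₁ refl))))
    ⟨a₁,a₂⟩ ⟨a₂,a₃⟩ ⟨a₁,a₃⟩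
  where
  positive : ∀ {a} → A3Roots a₁ a₂ a₃ a → PosA a
  positive root = proj₁ (from (roots _) root)

  classify : ∀ {a₁ a₂ a₃} → PosA {n} a₁ → PosA {n} a₂ → PosA {n} a₃ →
    dot a₁ a₂ + dot a₁ a₂ ≡ - dot a₁ a₁ → dot a₂ a₃ + dot a₂ a₃ ≡ - dot a₂ a₂ → dot a₁ a₃ ≡ 0ℤ →
    Chain a₁ a₂ a₃ ⊎ Chain a₃ a₂ a₁
  classify (diffA p<q) (diffA r<s) (diffA t<u) h₁₂ h₂₃ ⊥₁₃
    with pairing-−1 p<q r<s (halve _ (trans h₁₂ (cong -_ (dot-self p<q))))
       | pairing-−1 r<s t<u (halve _ (trans h₂₃ (cong -_ (dot-self r<s))))
  ... | inj₁ refl | inj₁ refl = inj₁ (chain p<q r<s t<u)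
  ... | inj₁ refl | inj₂ refl = ⊥-elim (pairing-common-end (FP.<⇒≢ p<q) (FP.<⇒≢ t<u) ⊥₁₃)
  ... | inj₂ refl | inj₁ refl = ⊥-elim (pairing-common-start (FP.<⇒≢ t<u) (>⇒≢ p<q) ⊥₁₃)
  ... | inj₂ refl | inj₂ refl = inj₂ (chain t<u r<s p<q)

-- inversion sets of 3142 and 2413; together they partition A3Roots
Shape3142 Shape2413 : Shape
Shape3142 a₁ a₂ a₃ β = (β ≡ a₁) ⊎ (β ≡ a₃) ⊎ (β ≡ a₁ +ᵥ a₂ +ᵥ a₃)
Shape2413 a₁ a₂ a₃ β = (β ≡ a₂) ⊎ (β ≡ a₁ +ᵥ a₂) ⊎ (β ≡ a₂ +ᵥ a₃)

-- an occurrence of the pattern with inversion set S, at simple roots a₁, a₂, a₃;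
-- Contains3142 and Contains2413 are ∃ a₁ a₂ a₃ of this
A3Pattern : ∀ {m} → (Vec ℤ m → Set) → (Vec ℤ m → Set) → Shape → Vec ℤ m → Vec ℤ m → Vec ℤ m → Set
A3Pattern Pos Inv S a₁ a₂ a₃ =
  IsA3Sub Pos a₁ a₂ a₃ × (∀ β → (Inv β × InSpan3 a₁ a₂ a₃ β) ⇔ S a₁ a₂ a₃ β)

Reversible : Shape → Set
Reversible S = ∀ {m} {a₁ a₂ a₃ β : Vec ℤ m} → S a₁ a₂ a₃ β → S a₃ a₂ a₁ β

reverse-sum₂ : ∀ {m} {a b β : Vec ℤ m} → β ≡ a +ᵥ b → β ≡ b +ᵥ a
reverse-sum₂ {a = a} {b} eq = trans eq (+ᵥ-comm a b)

reverse-sum₃ : ∀ {m} {a b c β : Vec ℤ m} → β ≡ a +ᵥ b +ᵥ c → β ≡ c +ᵥ b +ᵥ a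
reverse-sum₃ {a = a} {b} {c} eq = trans eq (+ᵥ-reverse a b c)

reversible-3142 : Reversible Shape3142
reversible-3142 (inj₁ eq) = inj₂ (inj₁ eq)
reversible-3142 (inj₂ (inj₁ eq)) = inj₁ eq
reversible-3142 (inj₂ (inj₂ eq)) = inj₂ (inj₂ (reverse-sum₃ eq))

reversible-2413 : Reversible Shape2413
reversible-2413 (inj₁ eq) = inj₁ eq
reversible-2413 (inj₂ (inj₁ eq)) = inj₂ (inj₂ (reverse-sum₂ eq))
reversible-2413 (inj₂ (inj₂ eq)) = inj₂ (inj₁ (reverse-sum₂ eq))

reversible-A3Roots : Reversible A3Roots
reversible-A3Roots (inj₁ eq) = inj₂ (inj₂ (inj₁ eq))
reversible-A3Roots (inj₂ (inj₁ eq)) = inj₂ (inj₁ eq)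
reversible-A3Roots (inj₂ (inj₂ (inj₁ eq))) = inj₁ eq
reversible-A3Roots (inj₂ (inj₂ (inj₂ (inj₁ eq)))) = inj₂ (inj₂ (inj₂ (inj₂ (inj₁ (reverse-sum₂ eq)))))
reversible-A3Roots (inj₂ (inj₂ (inj₂ (inj₂ (inj₁ eq))))) = inj₂ (inj₂ (inj₂ (inj₁ (reverse-sum₂ eq))))
reversible-A3Roots (inj₂ (inj₂ (inj₂ (inj₂ (inj₂ eq))))) = inj₂ (inj₂ (inj₂ (inj₂ (inj₂ (reverse-sum₃ eq)))))

reverse-span : ∀ {m} {a₁ a₂ a₃ β : Vec ℤ m} → InSpan3 a₁ a₂ a₃ β → InSpan3 a₃ a₂ a₁ β
reverse-span (c₀ , c₁ , c₂ , c₃ , c₀≢0 , eq) =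
  c₀ , c₃ , c₂ , c₁ , c₀≢0 , reverse-sum₃ eq

reverse-⇔ : ∀ {m} {P : Vec ℤ m → Set} (S : Shape) → Reversible S → ∀ {a₁ a₂ a₃ : Vec ℤ m} →
  (∀ β → (P β × InSpan3 a₁ a₂ a₃ β) ⇔ S a₁ a₂ a₃ β) →
  (∀ β → (P β × InSpan3 a₃ a₂ a₁ β) ⇔ S a₃ a₂ a₁ β)
reverse-⇔ S rev characterise β = mk⇔
  (λ (pβ , span) → rev (to (characterise β) (pβ , reverse-span span)))
  (λ s → let (pβ , span) = from (characterise β) (rev s) in pβ , reverse-span span)

reverse-A3Sub : ∀ {m} {Pos : Vec ℤ m → Set} {a₁ a₂ a₃} → IsA3Sub Pos a₁ a₂ a₃ → IsA3Sub Pos a₃ a₂ a₁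
reverse-A3Sub {a₁ = a₁} {a₂} {a₃} (‖a₁‖≡‖a₂‖ , ‖a₂‖≡‖a₃‖ , ⟨a₁,a₃⟩ , ⟨a₁,a₂⟩ , ⟨a₂,a₃⟩ , roots) =
  sym ‖a₂‖≡‖a₃‖ , sym ‖a₁‖≡‖a₂‖ ,
  trans (dot-comm a₃ a₁) ⟨a₁,a₃⟩ ,
  subst₂ (λ x y → x + x ≡ - y) (dot-comm a₂ a₃) ‖a₂‖≡‖a₃‖ ⟨a₂,a₃⟩ ,
  subst₂ (λ x y → x + x ≡ - y) (dot-comm a₁ a₂) ‖a₁‖≡‖a₂‖ ⟨a₁,a₂⟩ ,
  reverse-⇔ A3Roots reversible-A3Roots roots

reverse-A3Pattern : ∀ {m} {Pos Inv : Vec ℤ m → Set} {S : Shape} → Reversible S → ∀ {a₁ a₂ a₃} →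
  A3Pattern Pos Inv S a₁ a₂ a₃ → A3Pattern Pos Inv S a₃ a₂ a₁
reverse-A3Pattern {S = S} rev (sub , inversions) = reverse-A3Sub sub , reverse-⇔ S rev inversions

pattern-inversion : ∀ {m} {Pos Inv : Vec ℤ m → Set} {S : Shape} {a₁ a₂ a₃ ρ} →
  A3Pattern Pos Inv S a₁ a₂ a₃ → S a₁ a₂ a₃ ρ → Inv ρ
pattern-inversion (_ , inversions) s = proj₁ (from (inversions _) s)

pattern-non-inversion : ∀ {m} {Pos Inv : Vec ℤ m → Set} {S : Shape} {a₁ a₂ a₃ ρ} →
  A3Pattern Pos Inv S a₁ a₂ a₃ → A3Roots a₁ a₂ a₃ ρ → ¬ S a₁ a₂ a₃ ρ → ¬ Inv ρ
pattern-non-inversion (sub , inversions) root ¬s inv =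
  ¬s (to (inversions _) (inv , proj₂ (from (A3Sub-roots sub _) root)))

-- In A_n the functional ⟨a₁ + a₃, ·⟩ equals 2 on the roots of Shape3142 and
-- -2 or 0 on those of Shape2413, so the two shapes are disjoint.
module Separator {n : ℕ} {a₁ a₂ a₃ : Vec ℤ (suc n)} (sub : IsA3Sub (PosA {n}) a₁ a₂ a₃) where

  separator : Vec ℤ (suc n) → ℤ
  separator v = dot a₁ v + dot a₃ v

  separator-+ᵥ : ∀ u v → separator (u +ᵥ v) ≡ separator u + separator v
  separator-+ᵥ u v = trans (cong₂ _+_ (dot-+ʳ a₁ u v) (dot-+ʳ a₃ u v))
    (shuffle (dot a₁ u) (dot a₁ v) (dot a₃ u) (dot a₃ v))
    where
    shuffle : ∀ a b c d → (a + b) + (c + d) ≡ (a + c) + (b + d)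
    shuffle = solve-∀

  private
    ‖a₁‖ : dot a₁ a₁ ≡ + 2
    ‖a₁‖ = PosA-norm (proj₁ (from (A3Sub-roots sub a₁) (inj₁ refl)))
    ‖a₃‖ : dot a₃ a₃ ≡ + 2
    ‖a₃‖ = trans (sym (proj₁ (proj₂ sub))) (trans (sym (proj₁ sub)) ‖a₁‖)
    ⟨a₁,a₂⟩ : dot a₁ a₂ ≡ -[1+ 0 ]
    ⟨a₁,a₂⟩ = halve _ (trans (proj₁ (proj₂ (proj₂ (proj₂ sub)))) (cong -_ ‖a₁‖))
    ⟨a₂,a₃⟩ : dot a₂ a₃ ≡ -[1+ 0 ]
    ⟨a₂,a₃⟩ = halve _ (trans (proj₁ (proj₂ (proj₂ (proj₂ (proj₂ sub)))))
                            (cong -_ (trans (sym (proj₁ sub)) ‖a₁‖)))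
    ⟨a₁,a₃⟩ : dot a₁ a₃ ≡ 0ℤ
    ⟨a₁,a₃⟩ = proj₁ (proj₂ (proj₂ sub))

  separator-a₁ : separator a₁ ≡ + 2
  separator-a₁ = cong₂ _+_ ‖a₁‖ (trans (dot-comm a₃ a₁) ⟨a₁,a₃⟩)
  separator-a₂ : separator a₂ ≡ - + 2
  separator-a₂ = cong₂ _+_ ⟨a₁,a₂⟩ (trans (dot-comm a₃ a₂) ⟨a₂,a₃⟩)
  separator-a₃ : separator a₃ ≡ + 2
  separator-a₃ = cong₂ _+_ ⟨a₁,a₃⟩ ‖a₃‖

  separator-3142 : ∀ {β} → Shape3142 a₁ a₂ a₃ β → separator β ≡ + 2
  separator-3142 (inj₁ refl) = separator-a₁
  separator-3142 (inj₂ (inj₁ refl)) = separator-a₃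
  separator-3142 (inj₂ (inj₂ refl)) =
    trans (separator-+ᵥ (a₁ +ᵥ a₂) a₃) (trans (cong (_+ separator a₃) (separator-+ᵥ a₁ a₂))
      (cong₂ _+_ (cong₂ _+_ separator-a₁ separator-a₂) separator-a₃))

  separator-2413 : ∀ {β} → Shape2413 a₁ a₂ a₃ β → separator β ≢ + 2
  separator-2413 (inj₁ refl) eq with trans (sym separator-a₂) eq
  ... | ()
  separator-2413 (inj₂ (inj₁ refl)) eq
    with trans (sym (trans (separator-+ᵥ a₁ a₂) (cong₂ _+_ separator-a₁ separator-a₂))) eq
  ... | ()
  separator-2413 (inj₂ (inj₂ refl)) eq
    with trans (sym (trans (separator-+ᵥ a₂ a₃) (cong₂ _+_ separator-a₂ separator-a₃))) eq
  ... | ()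

  shapes-disjoint : ∀ {β} → Shape3142 a₁ a₂ a₃ β → ¬ Shape2413 a₁ a₂ a₃ β
  shapes-disjoint s₃₁₄₂ s₂₄₁₃ = separator-2413 s₂₄₁₃ (separator-3142 s₃₁₄₂)

-- the coordinate sum, which vanishes on the roots of A_n
total : ∀ {m} → Vec ℤ m → ℤ
total [] = 0ℤ
total (x ∷ v) = x + total v

total-+ᵥ : ∀ {m} (u v : Vec ℤ m) → total (u +ᵥ v) ≡ total u + total v
total-+ᵥ [] [] = refl
total-+ᵥ (x ∷ u) (y ∷ v) = trans (cong (λ a → (x + y) + a) (total-+ᵥ u v)) (shuffle x y (total u) (total v))
  where
  shuffle : ∀ x y a b → (x + y) + (a + b) ≡ (x + a) + (y + b)
  shuffle = solve-∀

total-• : ∀ {m} (c : ℤ) (u : Vec ℤ m) → total (c • u) ≡ c * total u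
total-• c [] = sym (ℤP.*-zeroʳ c)
total-• c (x ∷ u) = trans (cong (λ a → c * x + a) (total-• c u)) (sym (ℤP.*-distribˡ-+ c x (total u)))

total-negᵥ : ∀ {m} (u : Vec ℤ m) → total (negᵥ u) ≡ - total u
total-negᵥ [] = refl
total-negᵥ (x ∷ u) = trans (cong (λ a → - x + a) (total-negᵥ u)) (sym (ℤP.neg-distrib-+ x (total u)))

total-e : ∀ {m} (i : Fin m) → total (e i) ≡ 1ℤ
total-e {suc m} zero = cong (λ a → 1ℤ + a) (total-0 m)
  where
  total-0 : ∀ m → total (0ᵥ {m}) ≡ 0ℤ
  total-0 zero = refl
  total-0 (suc m) = trans (ℤP.+-identityˡ _) (total-0 m)
total-e {suc m} (suc i) = trans (ℤP.+-identityˡ _) (total-e i)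

total-ι : ∀ {n} (u : Vec ℤ n) → total (ι u) ≡ total u
total-ι [] = refl
total-ι (x ∷ u) = cong (λ a → x + a) (total-ι u)

PosA-total : ∀ {n} {γ} → PosA {n} γ → total γ ≡ 0ℤ
PosA-total (diffA {i} {j} _) rewrite total-+ᵥ (e i) (negᵥ (e j)) | total-negᵥ (e j) | total-e i | total-e j = refl

PosB-total⇒PosA : ∀ {n} {β : Vec ℤ n} → PosB β → total β ≡ 0ℤ → PosA {n} (ι β)
PosB-total⇒PosA (diffB {i} {j} i<j) _ = subst PosA (sym (ι-diff i j)) (diffA (inject₁-< i<j))
PosB-total⇒PosA (sumB {i} {j} _) sum≡0 rewrite total-+ᵥ (e i) (e j) | total-e i | total-e j with sum≡0
... | ()
PosB-total⇒PosA (shortB i) sum≡0 rewrite total-e i with sum≡0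
... | ()

span-total : ∀ {m} {b₁ b₂ b₃ β : Vec ℤ m} → total b₁ ≡ 0ℤ → total b₂ ≡ 0ℤ → total b₃ ≡ 0ℤ →
  InSpan3 b₁ b₂ b₃ β → total β ≡ 0ℤ
span-total {b₁ = b₁} {b₂} {b₃} {β} t₁ t₂ t₃ (c₀ , c₁ , c₂ , c₃ , c₀≢0 , eq)
  with ℤP.i*j≡0⇒i≡0∨j≡0 c₀ c₀total≡0
  where
  open ≡-Reasoning
  c₀total≡0 : c₀ * total β ≡ 0ℤ
  c₀total≡0 = begin
    c₀ * total β                                        ≡⟨ sym (total-• c₀ β) ⟩
    total (c₀ • β)                                      ≡⟨ cong total eq ⟩
    total (c₁ • b₁ +ᵥ c₂ • b₂ +ᵥ c₃ • b₃)                ≡⟨ total-+ᵥ (c₁ • b₁ +ᵥ c₂ • b₂) (c₃ • b₃) ⟩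
    total (c₁ • b₁ +ᵥ c₂ • b₂) + total (c₃ • b₃)        ≡⟨ cong (_+ total (c₃ • b₃)) (total-+ᵥ (c₁ • b₁) (c₂ • b₂)) ⟩
    total (c₁ • b₁) + total (c₂ • b₂) + total (c₃ • b₃) ≡⟨ cong₂ _+_ (cong₂ _+_ (total-• c₁ b₁) (total-• c₂ b₂)) (total-• c₃ b₃) ⟩
    c₁ * total b₁ + c₂ * total b₂ + c₃ * total b₃       ≡⟨ cong₂ _+_ (cong₂ _+_ (cong (c₁ *_) t₁) (cong (c₂ *_) t₂)) (cong (c₃ *_) t₃) ⟩
    c₁ * 0ℤ + c₂ * 0ℤ + c₃ * 0ℤ                         ≡⟨ cong₂ _+_ (cong₂ _+_ (ℤP.*-zeroʳ c₁) (ℤP.*-zeroʳ c₂)) (ℤP.*-zeroʳ c₃) ⟩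
    0ℤ                                                  ∎
... | inj₁ c₀≡0 = ⊥-elim (c₀≢0 c₀≡0)
... | inj₂ total≡0 = total≡0

linear₃ : ∀ {m k} (L : Vec ℤ m → Vec ℤ k) →
  (∀ u v → L (u +ᵥ v) ≡ L u +ᵥ L v) → (∀ c u → L (c • u) ≡ c • L u) →
  ∀ c₁ c₂ c₃ (x y z : Vec ℤ m) → L (c₁ • x +ᵥ c₂ • y +ᵥ c₃ • z) ≡ c₁ • L x +ᵥ c₂ • L y +ᵥ c₃ • L z
linear₃ L L-+ L-• c₁ c₂ c₃ x y z =
  trans (L-+ _ _) (cong₂ _+ᵥ_ (trans (L-+ _ _) (cong₂ _+ᵥ_ (L-• c₁ x) (L-• c₂ y))) (L-• c₃ z))

span-ι : ∀ {n} {β b₁ b₂ b₃ : Vec ℤ n} → InSpan3 b₁ b₂ b₃ β → InSpan3 (ι b₁) (ι b₂) (ι b₃) (ι β)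
span-ι {β = β} (c₀ , c₁ , c₂ , c₃ , c₀≢0 , eq) =
  c₀ , c₁ , c₂ , c₃ , c₀≢0 , trans (sym (ι-• c₀ β)) (trans (cong ι eq) (linear₃ ι ι-+ᵥ ι-• c₁ c₂ c₃ _ _ _))

span-ψ : ∀ {n} {β b₁ b₂ b₃ : Vec ℤ n} → InSpan3 (ι b₁) (ι b₂) (ι b₃) (ι β) → InSpan3 b₁ b₂ b₃ β
span-ψ {β = β} {b₁} {b₂} {b₃} (c₀ , c₁ , c₂ , c₃ , c₀≢0 , eq) =
  c₀ , c₁ , c₂ , c₃ , c₀≢0 ,
  subst₂ (λ u v → c₀ • u ≡ v) (ψ∘ι β)
    (cong₂ _+ᵥ_ (cong₂ _+ᵥ_ (cong (c₁ •_) (ψ∘ι b₁)) (cong (c₂ •_) (ψ∘ι b₂))) (cong (c₃ •_) (ψ∘ι b₃)))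
    (trans (sym (ψ-• c₀ (ι β))) (trans (cong ψ eq) (linear₃ ψ ψ-+ᵥ ψ-• c₁ c₂ c₃ _ _ _)))

-- shapes are described by linear equations, so ι (injective, additive) preserves them
ι-≡ : ∀ {n} {β b : Vec ℤ n} → (β ≡ b) ⇔ (ι β ≡ ι b)
ι-≡ = mk⇔ (cong ι) ι-injective

ι-≡₂ : ∀ {n} {β b c : Vec ℤ n} → (β ≡ b +ᵥ c) ⇔ (ι β ≡ ι b +ᵥ ι c)
ι-≡₂ {b = b} {c} = mk⇔ (λ eq → trans (cong ι eq) (ι-+ᵥ b c)) (λ eq → ι-injective (trans eq (sym (ι-+ᵥ b c))))

ι-≡₃ : ∀ {n} {β b c d : Vec ℤ n} → (β ≡ b +ᵥ c +ᵥ d) ⇔ (ι β ≡ ι b +ᵥ ι c +ᵥ ι d)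
ι-≡₃ {b = b} {c} {d} = mk⇔ (λ eq → trans (cong ι eq) ι-sum) (λ eq → ι-injective (trans eq (sym ι-sum)))
  where
  ι-sum : ι (b +ᵥ c +ᵥ d) ≡ ι b +ᵥ ι c +ᵥ ι d
  ι-sum = trans (ι-+ᵥ (b +ᵥ c) d) (cong (_+ᵥ ι d) (ι-+ᵥ b c))

ι-Invariant : Shape → Set
ι-Invariant S = ∀ {n} {b₁ b₂ b₃ β : Vec ℤ n} → S b₁ b₂ b₃ β ⇔ S (ι b₁) (ι b₂) (ι b₃) (ι β)

ι-A3Roots : ι-Invariant A3Roots
ι-A3Roots = ι-≡ ⊎-⇔ ι-≡ ⊎-⇔ ι-≡ ⊎-⇔ ι-≡₂ ⊎-⇔ ι-≡₂ ⊎-⇔ ι-≡₃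

ι-3142 : ι-Invariant Shape3142
ι-3142 = ι-≡ ⊎-⇔ ι-≡ ⊎-⇔ ι-≡₃

ι-2413 : ι-Invariant Shape2413
ι-2413 = ι-≡ ⊎-⇔ ι-≡₂ ⊎-⇔ ι-≡₂

restrict-along-ι : ∀ {n} {P : Vec ℤ n → Set} {Q : Vec ℤ (suc n) → Set} {S : Shape} → ι-Invariant S →
  ∀ {b₁ b₂ b₃} → (∀ {β} → InSpan3 b₁ b₂ b₃ β → P β ⇔ Q (ι β)) →
  (∀ γ → (Q γ × InSpan3 (ι b₁) (ι b₂) (ι b₃) γ) ⇔ S (ι b₁) (ι b₂) (ι b₃) γ) →
  ∀ β → (P β × InSpan3 b₁ b₂ b₃ β) ⇔ S b₁ b₂ b₃ β
restrict-along-ι ι-S P⇔Q characterise β = mk⇔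
  (λ (pβ , span) → from ι-S (to (characterise (ι β)) (to (P⇔Q span) pβ , span-ι span)))
  (λ s → let (qιβ , ιspan) = from (characterise (ι β)) (to ι-S s)
             span = span-ψ ιspan
         in from (P⇔Q span) qιβ , span)

module Transfer {n : ℕ} (w : SignedPerm n) (wA : Permutation′ (suc n)) (w-A : IsAPart w wA)
  {b₁ b₂ b₃ : Vec ℤ n} (subA : IsA3Sub (PosA {n}) (ι b₁) (ι b₂) (ι b₃)) where

  open InversionCorrespondence w wA w-A

  private
    total-simple : ∀ {b} → A3Roots (ι b₁) (ι b₂) (ι b₃) (ι b) → total b ≡ 0ℤ
    total-simple {b} root = trans (sym (total-ι b)) (PosA-total (proj₁ (from (A3Sub-roots subA _) root)))

  PosB⇔PosA : ∀ {β} → InSpan3 b₁ b₂ b₃ β → PosB β ⇔ PosA {n} (ι β)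
  PosB⇔PosA {β} span = mk⇔
    (λ p → PosB-total⇒PosA p (span-total (total-simple (inj₁ refl)) (total-simple (inj₂ (inj₁ refl)))
                                          (total-simple (inj₂ (inj₂ (inj₁ refl)))) span))
    (λ p → subst PosB (ψ∘ι β) (ψ-PosA p))

  InvB⇔InvA : ∀ {β} → InSpan3 b₁ b₂ b₃ β → InvB w β ⇔ InvA wA (ι β)
  InvB⇔InvA {β} span = mk⇔
    (λ inv → inv-B⇒A (to (PosB⇔PosA span) (proj₁ inv)) (subst (InvB w) (sym (ψ∘ι β)) inv))
    (λ inv → subst (InvB w) (ψ∘ι β) (inv-A⇒B inv))

  subB : IsA3Sub PosB b₁ b₂ b₃
  subB = restrict subA
    where
    restrict : IsA3Sub (PosA {n}) (ι b₁) (ι b₂) (ι b₃) → IsA3Sub PosB b₁ b₂ b₃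
    restrict (‖b₁‖≡‖b₂‖ , ‖b₂‖≡‖b₃‖ , ⟨b₁,b₃⟩ , ⟨b₁,b₂⟩ , ⟨b₂,b₃⟩ , roots) =
      subst₂ _≡_ (dot-ι b₁ b₁) (dot-ι b₂ b₂) ‖b₁‖≡‖b₂‖ ,
      subst₂ _≡_ (dot-ι b₂ b₂) (dot-ι b₃ b₃) ‖b₂‖≡‖b₃‖ ,
      subst (_≡ 0ℤ) (dot-ι b₁ b₃) ⟨b₁,b₃⟩ ,
      subst₂ (λ x y → x + x ≡ - y) (dot-ι b₁ b₂) (dot-ι b₁ b₁) ⟨b₁,b₂⟩ ,
      subst₂ (λ x y → x + x ≡ - y) (dot-ι b₂ b₃) (dot-ι b₂ b₂) ⟨b₂,b₃⟩ ,
      restrict-along-ι {S = A3Roots} ι-A3Roots PosB⇔PosA roots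

  transfer : ∀ {S : Shape} → ι-Invariant S →
    A3Pattern (PosA {n}) (InvA wA) S (ι b₁) (ι b₂) (ι b₃) → A3Pattern PosB (InvB w) S b₁ b₂ b₃
  transfer {S} ι-S (_ , inversions) = subB , restrict-along-ι {S = S} ι-S InvB⇔InvA inversions

B2Roots : ∀ {m} → Vec ℤ m → Vec ℤ m → Vec ℤ m → Set
B2Roots b₁ b₂ β = (β ≡ b₁) ⊎ (β ≡ b₂) ⊎ (β ≡ b₁ +ᵥ b₂) ⊎ (β ≡ b₁ +ᵥ b₂ +ᵥ b₂)

coordinate-≢0 : ∀ {m} (v : Vec ℤ m) {k z} → lookup v k ≡ z → z ≢ 0ℤ → lookup v k ≢ 0ℤ
coordinate-≢0 _ v-k≡z z≢0 v-k≡0 = z≢0 (trans (sym v-k≡z) v-k≡0)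

diff-start : ∀ {m} {k l : Fin m} → k F.< l → lookup (e k -ᵥ e l) k ≢ 0ℤ
diff-start {k = k} {l} k<l = coordinate-≢0 (e k -ᵥ e l)
  (trans (lookup--ᵥ (e k) (e l) k) (cong₂ _-_ (lookup-e-self k) (lookup-e-other (>⇒≢ k<l)))) (λ ())

diff-end : ∀ {m} {k l : Fin m} → k F.< l → lookup (e k -ᵥ e l) l ≢ 0ℤ
diff-end {k = k} {l} k<l = coordinate-≢0 (e k -ᵥ e l)
  (trans (lookup--ᵥ (e k) (e l) l) (cong₂ _-_ (lookup-e-other (FP.<⇒≢ k<l)) (lookup-e-self l))) (λ ())

sum-start : ∀ {m} {k l : Fin m} → k F.< l → lookup (e k +ᵥ e l) k ≢ 0ℤ
sum-start {k = k} {l} k<l = coordinate-≢0 (e k +ᵥ e l)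
  (trans (lookup-+ᵥ (e k) (e l) k) (cong₂ _+_ (lookup-e-self k) (lookup-e-other (>⇒≢ k<l)))) (λ ())

sum-end : ∀ {m} {k l : Fin m} → k F.< l → lookup (e k +ᵥ e l) l ≢ 0ℤ
sum-end {k = k} {l} k<l = coordinate-≢0 (e k +ᵥ e l)
  (trans (lookup-+ᵥ (e k) (e l) l) (cong₂ _+_ (lookup-e-other (FP.<⇒≢ k<l)) (lookup-e-self l))) (λ ())

module B2Subsystem {n : ℕ} {x y : Fin n} (x<y : x F.< y) where

  b₁ b₂ : Vec ℤ n
  b₁ = e x -ᵥ e y
  b₂ = e y

  span-support : ∀ {β} → InSpan2 b₁ b₂ β → ∀ k → lookup β k ≢ 0ℤ → (k ≡ x) ⊎ (k ≡ y)
  span-support {β} (c₀ , c₁ , c₂ , c₀≢0 , eq) k β-k≢0 with k F.≟ x | k F.≟ y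
  ... | yes k≡x | _ = inj₁ k≡x
  ... | no _ | yes k≡y = inj₂ k≡y
  ... | no k≢x | no k≢y with ℤP.i*j≡0⇒i≡0∨j≡0 c₀ c₀β-k≡0
    where
    x≢k : x ≢ k
    x≢k x≡k = k≢x (sym x≡k)
    y≢k : y ≢ k
    y≢k y≡k = k≢y (sym y≡k)
    open ≡-Reasoning
    c₀β-k≡0 : c₀ * lookup β k ≡ 0ℤ
    c₀β-k≡0 = begin
      c₀ * lookup β k                                       ≡⟨ sym (lookup-• c₀ β k) ⟩
      lookup (c₀ • β) k                                     ≡⟨ cong (λ v → lookup v k) eq ⟩
      lookup (c₁ • b₁ +ᵥ c₂ • b₂) k                          ≡⟨ lookup-+ᵥ (c₁ • b₁) (c₂ • b₂) k ⟩
      lookup (c₁ • b₁) k + lookup (c₂ • b₂) k                ≡⟨ cong₂ _+_ (lookup-• c₁ b₁ k) (lookup-• c₂ b₂ k) ⟩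
      c₁ * lookup b₁ k + c₂ * lookup b₂ k                    ≡⟨ cong₂ (λ a b → c₁ * a + c₂ * b) (lookup--ᵥ (e x) (e y) k) (lookup-e-other y≢k) ⟩
      c₁ * (lookup (e x) k - lookup (e y) k) + c₂ * 0ℤ       ≡⟨ cong₂ (λ a b → c₁ * (a - b) + c₂ * 0ℤ) (lookup-e-other x≢k) (lookup-e-other y≢k) ⟩
      c₁ * (0ℤ - 0ℤ) + c₂ * 0ℤ                              ≡⟨ cong₂ _+_ (ℤP.*-zeroʳ c₁) (ℤP.*-zeroʳ c₂) ⟩
      0ℤ                                                    ∎
  ... | inj₁ c₀≡0 = ⊥-elim (c₀≢0 c₀≡0)
  ... | inj₂ β-k≡0 = ⊥-elim (β-k≢0 β-k≡0)

  ordered-pair : ∀ {k l : Fin n} → k F.< l → (k ≡ x) ⊎ (k ≡ y) → (l ≡ x) ⊎ (l ≡ y) → (k ≡ x) × (l ≡ y)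
  ordered-pair _ (inj₁ k≡x) (inj₂ l≡y) = k≡x , l≡y
  ordered-pair k<l (inj₁ refl) (inj₁ refl) = ⊥-elim (FP.<⇒≢ k<l refl)
  ordered-pair k<l (inj₂ refl) (inj₂ refl) = ⊥-elim (FP.<⇒≢ k<l refl)
  ordered-pair k<l (inj₂ refl) (inj₁ refl) = ⊥-elim (FP.<⇒≢ (FP.<-trans k<l x<y) refl)

  positive-in-span⇒B2Root : ∀ {β} → PosB β → InSpan2 b₁ b₂ β → B2Roots b₁ b₂ β
  positive-in-span⇒B2Root (diffB k<l) span
    with ordered-pair k<l (span-support span _ (diff-start k<l)) (span-support span _ (diff-end k<l))
  ... | refl , refl = inj₁ refl
  positive-in-span⇒B2Root (sumB k<l) span
    with ordered-pair k<l (span-support span _ (sum-start k<l)) (span-support span _ (sum-end k<l))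
  ... | refl , refl = inj₂ (inj₂ (inj₂ (sym (-ᵥ-+ᵥ-+ᵥ (e x) (e y)))))
  positive-in-span⇒B2Root (shortB k) span with span-support span k (coordinate-≢0 (e k) (lookup-e-self k) (λ ()))
  ... | inj₁ refl = inj₂ (inj₂ (inj₁ (sym (-ᵥ-+ᵥ (e x) (e y)))))
  ... | inj₂ refl = inj₂ (inj₁ refl)

  B2Root⇒positive-in-span : ∀ {β} → B2Roots b₁ b₂ β → PosB β × InSpan2 b₁ b₂ β
  B2Root⇒positive-in-span (inj₁ refl) =
    diffB x<y , 1ℤ , 1ℤ , 0ℤ , (λ ()) , as-b₁ b₁ b₂
    where
    as-b₁ : ∀ {m} (u v : Vec ℤ m) → 1ℤ • u ≡ 1ℤ • u +ᵥ 0ℤ • v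
    as-b₁ [] [] = refl
    as-b₁ (a ∷ u) (b ∷ v) = cong₂ _∷_ (coordinate a b) (as-b₁ u v)
      where
      coordinate : ∀ a b → 1ℤ * a ≡ 1ℤ * a + 0ℤ * b
      coordinate = solve-∀
  B2Root⇒positive-in-span (inj₂ (inj₁ refl)) =
    shortB y , 1ℤ , 0ℤ , 1ℤ , (λ ()) , as-b₂ b₁ b₂
    where
    as-b₂ : ∀ {m} (u v : Vec ℤ m) → 1ℤ • v ≡ 0ℤ • u +ᵥ 1ℤ • v
    as-b₂ [] [] = refl
    as-b₂ (a ∷ u) (b ∷ v) = cong₂ _∷_ (coordinate a b) (as-b₂ u v)
      where
      coordinate : ∀ a b → 1ℤ * b ≡ 0ℤ * a + 1ℤ * b
      coordinate = solve-∀
  B2Root⇒positive-in-span (inj₂ (inj₂ (inj₁ refl))) =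
    subst PosB (sym (-ᵥ-+ᵥ (e x) (e y))) (shortB x) , 1ℤ , 1ℤ , 1ℤ , (λ ()) , as-b₁+b₂ b₁ b₂
    where
    as-b₁+b₂ : ∀ {m} (u v : Vec ℤ m) → 1ℤ • (u +ᵥ v) ≡ 1ℤ • u +ᵥ 1ℤ • v
    as-b₁+b₂ [] [] = refl
    as-b₁+b₂ (a ∷ u) (b ∷ v) = cong₂ _∷_ (coordinate a b) (as-b₁+b₂ u v)
      where
      coordinate : ∀ a b → 1ℤ * (a + b) ≡ 1ℤ * a + 1ℤ * b
      coordinate = solve-∀
  B2Root⇒positive-in-span (inj₂ (inj₂ (inj₂ refl))) =
    subst PosB (sym (-ᵥ-+ᵥ-+ᵥ (e x) (e y))) (sumB x<y) , 1ℤ , 1ℤ , + 2 , (λ ()) , as-b₁+2b₂ b₁ b₂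
    where
    as-b₁+2b₂ : ∀ {m} (u v : Vec ℤ m) → 1ℤ • (u +ᵥ v +ᵥ v) ≡ 1ℤ • u +ᵥ (+ 2) • v
    as-b₁+2b₂ [] [] = refl
    as-b₁+2b₂ (a ∷ u) (b ∷ v) = cong₂ _∷_ (coordinate a b) (as-b₁+2b₂ u v)
      where
      coordinate : ∀ a b → 1ℤ * (a + b + b) ≡ 1ℤ * a + (+ 2) * b
      coordinate = solve-∀

  isB2Sub : IsB2Sub PosB b₁ b₂
  isB2Sub =
    trans (dot-self x<y) (sym (cong₂ _+_ ‖b₂‖ ‖b₂‖)) ,
    trans ⟨b₁,b₂⟩ (sym (cong -_ ‖b₂‖)) ,
    (λ ‖b₂‖≡0 → 1≢0 (trans (sym ‖b₂‖) ‖b₂‖≡0)) ,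
    (λ β → mk⇔ (λ (p , span) → positive-in-span⇒B2Root p span) B2Root⇒positive-in-span)
    where
    ‖b₂‖ : dot b₂ b₂ ≡ 1ℤ
    ‖b₂‖ = trans (dot-ee y y) (δ-refl y)
    ⟨b₁,b₂⟩ : dot b₁ b₂ ≡ -[1+ 0 ]
    ⟨b₁,b₂⟩ rewrite dot--ˡ (e x) (e y) (e y) | dot-ee x y | dot-ee y y | δ-refl y | δ-≢ (FP.<⇒≢ x<y) = refl
    1≢0 : 1ℤ ≢ 0ℤ
    1≢0 ()

  module _ (w : SignedPerm n) where

    long-pattern : InvB w b₁ → InvB w (e x) → ¬ InvB w (e y) → ¬ InvB w (e x +ᵥ e y) →
      ContainsB2len2 PosB (InvB w)
    long-pattern inv-b₁ inv-x ¬inv-y ¬inv-x+y = b₁ , b₂ , isB2Sub , inj₁ (λ β → mk⇔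
      (λ (inv , span) → select inv (positive-in-span⇒B2Root (proj₁ inv) span))
      λ { (inj₁ refl) → inv-b₁ , proj₂ (B2Root⇒positive-in-span (inj₁ refl))
        ; (inj₂ refl) → subst (InvB w) (sym (-ᵥ-+ᵥ (e x) (e y))) inv-x ,
                        proj₂ (B2Root⇒positive-in-span (inj₂ (inj₂ (inj₁ refl)))) })
      where
      select : ∀ {β} → InvB w β → B2Roots b₁ b₂ β → (β ≡ b₁) ⊎ (β ≡ b₁ +ᵥ b₂)
      select inv (inj₁ eq) = inj₁ eq
      select inv (inj₂ (inj₁ refl)) = ⊥-elim (¬inv-y inv)
      select inv (inj₂ (inj₂ (inj₁ eq))) = inj₂ eq
      select inv (inj₂ (inj₂ (inj₂ refl))) = ⊥-elim (¬inv-x+y (subst (InvB w) (-ᵥ-+ᵥ-+ᵥ (e x) (e y)) inv))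

    short-pattern : InvB w (e y) → InvB w (e x +ᵥ e y) → ¬ InvB w b₁ → ¬ InvB w (e x) →
      ContainsB2len2 PosB (InvB w)
    short-pattern inv-y inv-x+y ¬inv-b₁ ¬inv-x = b₁ , b₂ , isB2Sub , inj₂ (λ β → mk⇔
      (λ (inv , span) → select inv (positive-in-span⇒B2Root (proj₁ inv) span))
      λ { (inj₁ refl) → inv-y , proj₂ (B2Root⇒positive-in-span (inj₂ (inj₁ refl)))
        ; (inj₂ refl) → subst (InvB w) (sym (-ᵥ-+ᵥ-+ᵥ (e x) (e y))) inv-x+y ,
                        proj₂ (B2Root⇒positive-in-span (inj₂ (inj₂ (inj₂ refl)))) })
      where
      select : ∀ {β} → InvB w β → B2Roots b₁ b₂ β → (β ≡ b₂) ⊎ (β ≡ b₁ +ᵥ b₂ +ᵥ b₂)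
      select inv (inj₁ refl) = ⊥-elim (¬inv-b₁ inv)
      select inv (inj₂ (inj₁ eq)) = inj₁ eq
      select inv (inj₂ (inj₂ (inj₁ refl))) = ⊥-elim (¬inv-x (subst (InvB w) (-ᵥ-+ᵥ (e x) (e y)) inv))
      select inv (inj₂ (inj₂ (inj₂ eq))) = inj₂ eq

-- In B_n, for a < b < c, the inversion data that an A₃ pattern of w_A on
-- a chain ending at the last index induces on e_a - e_b, e_b - e_c,
-- e_a - e_c, e_a, e_b, e_c forces a B₂ pattern of length two.  Whether
-- e_b + e_c is an inversion decides which one.

module ForcedB2 {n : ℕ} (w : SignedPerm n) {a b c : Fin n} (a<b : a F.< b) (b<c : b F.< c) where

  open Biconvexity w

  a<c : a F.< c
  a<c = FP.<-trans a<b b<c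

  e_a+e_b : e a +ᵥ e b ≡ (e b +ᵥ e c) +ᵥ (e a -ᵥ e c)
  e_a+e_b = +ᵥ-via (e a) (e b) (e c)

  from-3142 : InvB w (e a -ᵥ e b) → InvB w (e c) → InvB w (e a) →
    ¬ InvB w (e b -ᵥ e c) → ¬ InvB w (e a -ᵥ e c) → ¬ InvB w (e b) → ContainsB2len2 PosB (InvB w)
  from-3142 inv-ab inv-c inv-a ¬inv-bc ¬inv-ac ¬inv-b with inversion? (sumB b<c)
  ... | inj₁ inv-b+c = B2Subsystem.short-pattern b<c w inv-c inv-b+c ¬inv-bc ¬inv-b
  ... | inj₂ ¬inv-b+c = B2Subsystem.long-pattern a<b w inv-ab inv-a ¬inv-b
          (co-closed (sumB b<c) (diffB a<c) e_a+e_b ¬inv-b+c ¬inv-ac)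

  from-2413 : InvB w (e b -ᵥ e c) → InvB w (e a -ᵥ e c) → InvB w (e b) →
    ¬ InvB w (e a -ᵥ e b) → ¬ InvB w (e c) → ¬ InvB w (e a) → ContainsB2len2 PosB (InvB w)
  from-2413 inv-bc inv-ac inv-b ¬inv-ab ¬inv-c ¬inv-a with inversion? (sumB b<c)
  ... | inj₂ ¬inv-b+c = B2Subsystem.long-pattern b<c w inv-bc inv-b ¬inv-c ¬inv-b+c
  ... | inj₁ inv-b+c = B2Subsystem.short-pattern a<b w inv-b
          (closed (sumB a<b) e_a+e_b inv-b+c inv-ac) ¬inv-ab ¬inv-a

-- A_n has no B₂ subsystem: all its roots have the same length
no-B2-in-A : ∀ {n} {Inv : Vec ℤ (suc n) → Set} → ¬ ContainsB2len2 (PosA {n}) Inv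
no-B2-in-A (b₁ , b₂ , (‖b₁‖≡2‖b₂‖ , _ , _ , roots) , _)
  with trans (sym (PosA-norm (proj₁ (from (roots b₁) (inj₁ refl)))))
             (trans ‖b₁‖≡2‖b₂‖ (cong₂ _+_ ‖b₂‖ ‖b₂‖))
  where
  ‖b₂‖ : dot b₂ b₂ ≡ + 2
  ‖b₂‖ = PosA-norm (proj₁ (from (roots b₂) (inj₂ (inj₁ refl))))
... | ()

module FromAtoB {n : ℕ} (w : SignedPerm n) (wA : Permutation′ (suc n)) (w-A : IsAPart w wA) where

  open InversionCorrespondence w wA w-A

  E : Fin (suc n) → Fin (suc n) → Vec ℤ (suc n)
  E i j = e i -ᵥ e j

  L : Fin (suc n)
  L = fromℕ n

  inner : ∀ {a b : Fin n} → InvA wA (E (inject₁ a) (inject₁ b)) → InvB w (e a -ᵥ e b)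
  inner {a} {b} inv = subst (InvB w) (ψ-diff-inject a b) (inv-A⇒B inv)

  ¬inner : ∀ {a b : Fin n} → a F.< b → ¬ InvA wA (E (inject₁ a) (inject₁ b)) → ¬ InvB w (e a -ᵥ e b)
  ¬inner {a} {b} a<b ¬inv inv =
    ¬inv (inv-B⇒A (diffA (inject₁-< a<b)) (subst (InvB w) (sym (ψ-diff-inject a b)) inv))

  to-last : ∀ {a : Fin n} → InvA wA (E (inject₁ a) L) → InvB w (e a)
  to-last {a} inv = subst (InvB w) (ψ-diff-last a) (inv-A⇒B inv)

  ¬to-last : ∀ {a : Fin n} → ¬ InvA wA (E (inject₁ a) L) → ¬ InvB w (e a)
  ¬to-last {a} ¬inv inv =
    ¬inv (inv-B⇒A (diffA (inject₁<last a)) (subst (InvB w) (sym (ψ-diff-last a)) inv))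

  AtLast : Shape → Set
  AtLast S = ∀ {a b c : Fin n} → a F.< b → b F.< c →
    A3Pattern (PosA {n}) (InvA wA) S (E (inject₁ a) (inject₁ b)) (E (inject₁ b) (inject₁ c)) (E (inject₁ c) L) →
    ContainsB2len2 PosB (InvB w)

  3142-at-last : AtLast Shape3142
  3142-at-last {a} {b} {c} a<b b<c pat =
    ForcedB2.from-3142 w a<b b<c inv-ab inv-c inv-a ¬inv-bc ¬inv-ac ¬inv-b
    where
    a₁ a₂ a₃ : Vec ℤ (suc n)
    a₁ = E (inject₁ a) (inject₁ b)
    a₂ = E (inject₁ b) (inject₁ c)
    a₃ = E (inject₁ c) L
    open Separator (proj₁ pat)
    inverted : ∀ {ρ} → Shape3142 a₁ a₂ a₃ ρ → InvA wA ρ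
    inverted = pattern-inversion {S = Shape3142} pat
    excluded : ∀ {ρ} → A3Roots a₁ a₂ a₃ ρ → Shape2413 a₁ a₂ a₃ ρ → ¬ InvA wA ρ
    excluded root s = pattern-non-inversion {S = Shape3142} pat root (λ s′ → shapes-disjoint s′ s)
    inv-ab : InvB w (e a -ᵥ e b)
    inv-ab = inner (inverted (inj₁ refl))
    inv-c : InvB w (e c)
    inv-c = to-last (inverted (inj₂ (inj₁ refl)))
    inv-a : InvB w (e a)
    inv-a = to-last (subst (InvA wA) (telescope₃ _ _ _ _) (inverted (inj₂ (inj₂ refl))))
    ¬inv-bc : ¬ InvB w (e b -ᵥ e c)
    ¬inv-bc = ¬inner b<c (excluded (inj₂ (inj₁ refl)) (inj₁ refl))
    ¬inv-ac : ¬ InvB w (e a -ᵥ e c)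
    ¬inv-ac = ¬inner (FP.<-trans a<b b<c) λ inv →
      excluded (inj₂ (inj₂ (inj₂ (inj₁ refl)))) (inj₂ (inj₁ refl)) (subst (InvA wA) (sym (telescope _ _ _)) inv)
    ¬inv-b : ¬ InvB w (e b)
    ¬inv-b = ¬to-last λ inv →
      excluded (inj₂ (inj₂ (inj₂ (inj₂ (inj₁ refl))))) (inj₂ (inj₂ refl)) (subst (InvA wA) (sym (telescope _ _ _)) inv)

  2413-at-last : AtLast Shape2413
  2413-at-last {a} {b} {c} a<b b<c pat =
    ForcedB2.from-2413 w a<b b<c inv-bc inv-ac inv-b ¬inv-ab ¬inv-c ¬inv-a
    where
    a₁ a₂ a₃ : Vec ℤ (suc n)
    a₁ = E (inject₁ a) (inject₁ b)
    a₂ = E (inject₁ b) (inject₁ c)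
    a₃ = E (inject₁ c) L
    open Separator (proj₁ pat)
    inverted : ∀ {ρ} → Shape2413 a₁ a₂ a₃ ρ → InvA wA ρ
    inverted = pattern-inversion {S = Shape2413} pat
    excluded : ∀ {ρ} → A3Roots a₁ a₂ a₃ ρ → Shape3142 a₁ a₂ a₃ ρ → ¬ InvA wA ρ
    excluded root s = pattern-non-inversion {S = Shape2413} pat root (shapes-disjoint s)
    inv-bc : InvB w (e b -ᵥ e c)
    inv-bc = inner (inverted (inj₁ refl))
    inv-ac : InvB w (e a -ᵥ e c)
    inv-ac = inner (subst (InvA wA) (telescope _ _ _) (inverted (inj₂ (inj₁ refl))))
    inv-b : InvB w (e b)
    inv-b = to-last (subst (InvA wA) (telescope _ _ _) (inverted (inj₂ (inj₂ refl))))
    ¬inv-ab : ¬ InvB w (e a -ᵥ e b)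
    ¬inv-ab = ¬inner a<b (excluded (inj₁ refl) (inj₁ refl))
    ¬inv-c : ¬ InvB w (e c)
    ¬inv-c = ¬to-last (excluded (inj₂ (inj₂ (inj₁ refl))) (inj₂ (inj₁ refl)))
    ¬inv-a : ¬ InvB w (e a)
    ¬inv-a = ¬to-last λ inv →
      excluded (inj₂ (inj₂ (inj₂ (inj₂ (inj₂ refl))))) (inj₂ (inj₂ refl)) (subst (InvA wA) (sym (telescope₃ _ _ _ _)) inv)

  -- a pattern of w_A on a chain: either it ends at the last index and
  -- forces a B₂ pattern of w, or it lies in x_n = 0 and is a pattern of w
  chain-pattern : ∀ {S : Shape} → ι-Invariant S → AtLast S →
    ¬ ContainsB2len2 PosB (InvB w) → ¬ (∃ λ b₁ → ∃ λ b₂ → ∃ λ b₃ → A3Pattern PosB (InvB w) S b₁ b₂ b₃) →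
    ∀ {a₁ a₂ a₃} → Chain a₁ a₂ a₃ → ¬ A3Pattern (PosA {n}) (InvA wA) S a₁ a₂ a₃
  chain-pattern {S} ι-S at-last ¬B2 ¬S (chain {p} {q} {r} {s} p<q q<r r<s) pat
    with below⇒inject p<q | below⇒inject q<r | below⇒inject r<s
  ... | a , refl | b , refl | c , refl with last-or-inject s
  ...   | last = ¬B2 (at-last (inject₁-<⁻ p<q) (inject₁-<⁻ q<r) pat)
  ...   | inject d = ¬S (e a -ᵥ e b , e b -ᵥ e c , e c -ᵥ e d ,
                        Transfer.transfer w wA w-A (proj₁ patι) {S} ι-S patι)
    where
    patι : A3Pattern (PosA {n}) (InvA wA) S (ι (e a -ᵥ e b)) (ι (e b -ᵥ e c)) (ι (e c -ᵥ e d))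
    patι = subst₂ (λ u v → A3Pattern (PosA {n}) (InvA wA) S u v (ι (e c -ᵥ e d)))
             (sym (ι-diff a b)) (sym (ι-diff b c))
             (subst (A3Pattern (PosA {n}) (InvA wA) S _ _) (sym (ι-diff c d)) pat)

  -- up to reversal, every A₃ pattern of w_A sits on a chain
  avoids : ∀ {S : Shape} → Reversible S → ι-Invariant S → AtLast S →
    ¬ ContainsB2len2 PosB (InvB w) → ¬ (∃ λ b₁ → ∃ λ b₂ → ∃ λ b₃ → A3Pattern PosB (InvB w) S b₁ b₂ b₃) →
    ¬ (∃ λ a₁ → ∃ λ a₂ → ∃ λ a₃ → A3Pattern (PosA {n}) (InvA wA) S a₁ a₂ a₃)
  avoids {S} rev ι-S at-last ¬B2 ¬S (_ , _ , _ , pat) with A3Sub-chain (proj₁ pat)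
  ... | inj₁ ch = chain-pattern {S} ι-S at-last ¬B2 ¬S ch pat
  ... | inj₂ ch = chain-pattern {S} ι-S at-last ¬B2 ¬S ch (reverse-A3Pattern {S = S} rev pat)

lemma6p8 : (n : ℕ) (w : SignedPerm n) (wA : Permutation′ (suc n)) →
    IsAPart w wA →
    AvoidsAll (PosB {n}) (InvB w) →
    AvoidsAll (PosA {n}) (InvA wA)
lemma6p8 n w wA w-A (¬3142 , ¬2413 , ¬B2) =
  avoids {S = Shape3142} reversible-3142 ι-3142 3142-at-last ¬B2 ¬3142 ,
  avoids {S = Shape2413} reversible-2413 ι-2413 2413-at-last ¬B2 ¬2413 ,
  no-B2-in-A
  where
  open FromAtoB w wA w-A
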